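{- For $s,t\in\mathbb N$ and $\alpha,\beta\in\mathbb Z/N\mathbb Z$, $$[s;\alpha]\cdot[t;\beta]=[s,t;\alpha,\beta]+[t,s;\beta,\alpha]+\delta_{\alpha,\beta}[s+t;\alpha]+\sum_{j=1}^s\lambda^{j;N}_{s,t;\alpha-\beta}[j;\alpha]+\sum_{j=1}^t\lambda^{j;N}_{t,s;\beta-\alpha}[j;\beta].$$
   Context: $N\ge1$, $\eta=e^{2\pi i/N}$, $\mathbb N=\{1,2,\dots\}$. For $\mathbf s\in\mathbb N^d$, $\boldsymbol\alpha\in(\mathbb Z/N\mathbb Z)^d$, $[\mathbf s;\boldsymbol\alpha]=\frac{1}{\prod_j(s_j-1)!}\sum_{n\ge1}\big(\sum_{u_1v_1+\cdots+u_dv_d=n,\ u_1>\cdots>u_d>0,\ v_j\ge1}\eta^{\sum_j\alpha_jv_j}\prod_jv_j^{s_j-1}\big)q^n$. Define $\omega^N_{n;\alpha}$ ($n\ge0$) by $\frac{1}{\eta^\alpha e^x-1}=\frac{\delta_{\alpha,0}}{x}+\sum_{n\ge0}\frac{\omega^N_{n;\alpha}}{n!}x^n$ and $\lambda^{j;N}_{a,b;\alpha}=(-1)^{b-1}\binom{a+b-j-1}{a-j}\frac{\omega^N_{a+b-j-1;\alpha}}{(a+b-j-1)!}$. $\delta$ is the Kronecker delta. -}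

module Defs where

open import Level using (Level; _⊔_) renaming (suc to lsuc)
open import Algebra.Bundles using (CommutativeRing)
open import Data.Nat using (ℕ; zero; suc; _∸_; _<_; _≟_; _<?_; _!) renaming (_+_ to _+ℕ_; _*_ to _*ℕ_)
open import Data.Nat.Combinatorics using (_C_)
open import Data.Nat.DivMod using (_%_; m%n<n)
open import Data.Fin using (Fin; toℕ; fromℕ<)
open import Data.Fin.Properties using () renaming (_≟_ to _≟ᶠ_)
open import Data.Bool using (if_then_else_)
open import Data.Product using (_×_)
open import Relation.Nullary using (¬_)
open import Relation.Nullary.Decidable using (⌊_⌋)

module RingOps {c ℓ : Level} (R : CommutativeRing c ℓ) where
  open CommutativeRing R

  fromℕ : ℕ → Carrier
  fromℕ zero    = 0#
  fromℕ (suc n) = 1# + fromℕ n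

  pow : Carrier → ℕ → Carrier
  pow x zero    = 1#
  pow x (suc n) = x * pow x n

record CharZeroField (c ℓ : Level) : Set (lsuc (c ⊔ ℓ)) where
  field
    commRing : CommutativeRing c ℓ
  open CommutativeRing commRing public
  open RingOps commRing public
  field
    _⁻¹      : Carrier → Carrier
    inverse  : ∀ x → ¬ (x ≈ 0#) → x * (x ⁻¹) ≈ 1#
    charZero : ∀ n → ¬ (fromℕ (suc n) ≈ 0#)

-- Subtraction in ℤ/Nℤ, represented as Fin (suc M)  (N = suc M ≥ 1)

_⊖_ : {M : ℕ} → Fin (suc M) → Fin (suc M) → Fin (suc M)
_⊖_ {M} α β = fromℕ< (m%n<n (toℕ α +ℕ (suc M ∸ toℕ β)) (suc M))

module WithField {c ℓ : Level} (F : CharZeroField c ℓ) where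
  open CharZeroField F public

  -- 1 / k  (k a natural number, nonzero in the uses below)
  invℕ : ℕ → Carrier
  invℕ k = (fromℕ k) ⁻¹

  sum1 : ℕ → (ℕ → Carrier) → Carrier
  sum1 zero    f = 0#
  sum1 (suc n) f = sum1 n f + f (suc n)

  sum0 : ℕ → (ℕ → Carrier) → Carrier
  sum0 n f = f 0 + sum1 n f

  IsPrimitiveRoot : ℕ → Carrier → Set ℓ
  IsPrimitiveRoot N η = (pow η N ≈ 1#) × (∀ k → 0 < k → k < N → ¬ (pow η k ≈ 1#))

  δ : {M : ℕ} → Fin (suc M) → Fin (suc M) → Carrier
  δ α β = if ⌊ α ≟ᶠ β ⌋ then 1# else 0#

  δℕ : ℕ → ℕ → Carrier
  δℕ m n = if ⌊ m ≟ n ⌋ then 1# else 0#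

  -- coefficient of x^m in  η^α e^x − 1
  expCoeff : {M : ℕ} → Carrier → Fin (suc M) → ℕ → Carrier
  expCoeff η α m = pow η (toℕ α) * invℕ (m !) - δℕ m 0

  -- ω is the coefficient family defined by
  --   1/(η^α e^x − 1) = δ_{α,0}/x + Σ_{n≥0} ω_{n;α} x^n / n!,
  -- i.e. (η^α e^x − 1)·(δ_{α,0} x^{-1} + Σ ω_{n;α} x^n/n!) = 1 as formal
  -- Laurent series, written out coefficientwise (x^{-1} and x^n, n ≥ 0).
  IsOmega : (M : ℕ) → Carrier → (ℕ → Fin (suc M) → Carrier) → Set ℓ
  IsOmega M η ω = ∀ (α : Fin (suc M)) →
      (δ α Fin.zero * expCoeff η α 0 ≈ 0#)
    × (∀ n → δ α Fin.zero * expCoeff η α (suc n)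
               + sum0 n (λ k → expCoeff η α (n ∸ k) * (ω k α * invℕ (k !)))
             ≈ δℕ n 0)

  -- q^n-coefficient of [s; α]
  bracket1 : {M : ℕ} → Carrier → ℕ → Fin (suc M) → ℕ → Carrier
  bracket1 η s α n =
    invℕ ((s ∸ 1) !) *
    sum1 n (λ u → sum1 n (λ v →
      if ⌊ u *ℕ v ≟ n ⌋
      then pow η (toℕ α *ℕ v) * pow (fromℕ v) (s ∸ 1)
      else 0#))

  -- q^n-coefficient of [s, t; α, β]
  bracket2 : {M : ℕ} → Carrier → ℕ → ℕ → Fin (suc M) → Fin (suc M) → ℕ → Carrier
  bracket2 η s t α β n =
    (invℕ ((s ∸ 1) !) * invℕ ((t ∸ 1) !)) *
    sum1 n (λ u₁ → sum1 n (λ v₁ → sum1 n (λ u₂ → sum1 n (λ v₂ →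
      if ⌊ u₁ *ℕ v₁ +ℕ u₂ *ℕ v₂ ≟ n ⌋
      then (if ⌊ u₂ <? u₁ ⌋
            then pow η (toℕ α *ℕ v₁ +ℕ toℕ β *ℕ v₂)
                   * (pow (fromℕ v₁) (s ∸ 1) * pow (fromℕ v₂) (t ∸ 1))
            else 0#)
      else 0#))))

  prodCoeff : (ℕ → Carrier) → (ℕ → Carrier) → ℕ → Carrier
  prodCoeff f g n = sum0 n (λ k → f k * g (n ∸ k))

  lam : {M : ℕ} → (ℕ → Fin (suc M) → Carrier) → ℕ → ℕ → ℕ → Fin (suc M) → Carrier
  lam ω j a b γ =
    pow (- 1#) (b ∸ 1)
      * (fromℕ ((a +ℕ b ∸ j ∸ 1) C (a ∸ j))
      * (ω (a +ℕ b ∸ j ∸ 1) γ * invℕ ((a +ℕ b ∸ j ∸ 1) !)))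

-- Expanding both q-series, the q^n-coefficient of [s;α]·[t;β] is a sum over quadruples
-- (u₁,v₁,u₂,v₂) with u₁v₁ + u₂v₂ = n.  The part with u₁ > u₂ is [s,t;α,β], the part with
-- u₁ < u₂ is [t,s;β,α].  On the diagonal u₁ = u₂ = u one groups by m = v₁ + v₂, a divisor
-- of n, and meets the twisted convolution Σ_{0<v<m} η^{αv+β(m−v)} v^{s−1} (m−v)^{t−1}.
-- Writing η^α = η^β ζ with ζ = η^{α−β}, this convolution has a closed form: in the exponents
-- (a,b) both sides satisfy f(a,b+1) = m·f(a,b) − f(a+1,b), and for b = 0 the power sum
-- Σ_{v<m} ζ^v v^a telescopes against the Appell polynomials of the coefficients ω_{k;α−β}.
-- The coefficients for β−α enter through ω_{k;β−α} = −(−1)^k ω_{k;α−β} − δ_{k,0}, which holds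
-- because both sides solve the same recurrence.  Summing the closed form over the divisors
-- of n produces δ_{α,β}[s+t;α] and the two λ-sums.

module Submission where

open import Defs
open import Level using (Level)
open import Algebra.Bundles using (CommutativeRing)
open import Data.Nat as ℕ using (ℕ; zero; suc; z≤n; s≤s; _≤_; _<_; _∸_; _!; _≟_; _<?_; _≤?_; _%_; _/_; NonZero)
  renaming (_+_ to _+ℕ_; _*_ to _*ℕ_)
import Data.Nat.Properties as ℕ
open import Data.Nat.Properties using (_!≢0; _!*_!≢0)
open import Data.Nat.Combinatorics using (_C_; k>n⇒nCk≡0; nCk+nC[k+1]≡[n+1]C[k+1]; nCn≡1; nCk≡nC[n∸k])
open import Data.Nat.DivMod using (n%n≡0; m≡m%n+[m/n]*n)
open import Data.Nat.Induction using (<-rec)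
open import Data.Fin as Fin using (Fin; toℕ)
import Data.Fin.Properties as Fin
open import Data.Bool using (if_then_else_)
open import Data.Empty using (⊥-elim)
open import Data.Product using (proj₁; proj₂)
open import Data.Sum using (_⊎_; inj₁; inj₂)
open import Relation.Nullary using (¬_; Dec; yes; no)
open import Relation.Nullary.Decidable using (⌊_⌋)
open import Relation.Binary.Definitions using (tri<; tri≈; tri>)
open import Relation.Binary.PropositionalEquality as P using (_≡_; _≢_)

module ℕ-Lemmas where
  open import Data.Nat
  open import Data.Nat.Properties
  open import Data.Nat.Combinatorics using (_C_; nCk≡n!/k![n-k]!; k![n∸k]!∣n!; nCk≡nC[n∸k]; nC1≡n)
  open import Data.Nat.DivMod using (m/n*n≡m; [m+n]%n≡m%n; m<n⇒m%n≡m)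
  open import Data.Nat.Solver using (module +-*-Solver)
  open import Relation.Binary.PropositionalEquality
  open +-*-Solver using (solve; _:=_; _:+_; _:*_; con)
  open ≡-Reasoning

  nCk*[k!*[n∸k]!]≡n! : ∀ {n k} → k ≤ n → (n C k) * (k ! * (n ∸ k) !) ≡ n !
  nCk*[k!*[n∸k]!]≡n! {n} {k} k≤n = begin
    (n C k) * (k ! * (n ∸ k) !)                            ≡⟨ cong (_* (k ! * (n ∸ k) !)) (nCk≡n!/k![n-k]! k≤n) ⟩
    (n ! / (k ! * (n ∸ k) !)) * (k ! * (n ∸ k) !)          ≡⟨ m/n*n≡m (k![n∸k]!∣n! k≤n) ⟩
    n ! ∎
    where instance _ = k !* (n ∸ k) !≢0

  nCm*mCk≡nCk*[n∸k]C[m∸k] : ∀ {n m k} → k ≤ m → m ≤ n →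
    (n C m) * (m C k) ≡ (n C k) * ((n ∸ k) C (m ∸ k))
  nCm*mCk≡nCk*[n∸k]C[m∸k] {n} {m} {k} k≤m m≤n =
    *-cancelʳ-≡ _ _ (k ! * ((m ∸ k) ! * (n ∸ m) !)) (begin
      (n C m) * (m C k) * (k ! * ((m ∸ k) ! * (n ∸ m) !))
        ≡⟨ solve 5 (λ A B x y z → (A :* B) :* (x :* (y :* z)) := A :* ((B :* (x :* y)) :* z))
                   refl (n C m) (m C k) (k !) ((m ∸ k) !) ((n ∸ m) !) ⟩
      (n C m) * ((m C k) * (k ! * (m ∸ k) !) * (n ∸ m) !)  ≡⟨ cong (λ z → (n C m) * (z * (n ∸ m) !)) (nCk*[k!*[n∸k]!]≡n! k≤m) ⟩
      (n C m) * (m ! * (n ∸ m) !)                          ≡⟨ nCk*[k!*[n∸k]!]≡n! m≤n ⟩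
      n !                                                  ≡⟨ nCk*[k!*[n∸k]!]≡n! (≤-trans k≤m m≤n) ⟨
      (n C k) * (k ! * (n ∸ k) !)                          ≡⟨ cong (λ z → (n C k) * (k ! * z)) (nCk*[k!*[n∸k]!]≡n! (∸-monoˡ-≤ k m≤n)) ⟨
      (n C k) * (k ! * (((n ∸ k) C (m ∸ k)) * ((m ∸ k) ! * ((n ∸ k) ∸ (m ∸ k)) !)))
        ≡⟨ cong (λ z → (n C k) * (k ! * (((n ∸ k) C (m ∸ k)) * ((m ∸ k) ! * z !)))) n∸k∸[m∸k]≡n∸m ⟩
      (n C k) * (k ! * (((n ∸ k) C (m ∸ k)) * ((m ∸ k) ! * (n ∸ m) !)))
        ≡⟨ solve 5 (λ A B x y z → A :* (x :* (B :* (y :* z))) := (A :* B) :* (x :* (y :* z)))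
                   refl (n C k) ((n ∸ k) C (m ∸ k)) (k !) ((m ∸ k) !) ((n ∸ m) !) ⟩
      (n C k) * ((n ∸ k) C (m ∸ k)) * (k ! * ((m ∸ k) ! * (n ∸ m) !)) ∎)
    where
    instance _ = m*n≢0 (k !) ((m ∸ k) ! * (n ∸ m) !) {{k !≢0}} {{m*n≢0 _ _ {{(m ∸ k) !≢0}} {{(n ∸ m) !≢0}}}}
    n∸k∸[m∸k]≡n∸m : (n ∸ k) ∸ (m ∸ k) ≡ n ∸ m
    n∸k∸[m∸k]≡n∸m = trans (∸-+-assoc n k (m ∸ k)) (cong (n ∸_) (m+[n∸m]≡n k≤m))

  [1+n]Ck*[1+n∸k]≡nCk*[1+n] : ∀ {n k} → k ≤ n → (suc n C k) * (suc n ∸ k) ≡ (n C k) * suc n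
  [1+n]Ck*[1+n∸k]≡nCk*[1+n] {n} {k} k≤n = *-cancelʳ-≡ _ _ (k ! * (n ∸ k) !) (begin
    (suc n C k) * (suc n ∸ k) * (k ! * (n ∸ k) !)  ≡⟨ cong (λ z → (suc n C k) * z * (k ! * (n ∸ k) !)) (+-∸-assoc 1 k≤n) ⟩
    (suc n C k) * suc (n ∸ k) * (k ! * (n ∸ k) !)
      ≡⟨ solve 4 (λ A d x y → (A :* (con 1 :+ d)) :* (x :* y) := A :* (x :* (y :+ d :* y)))
                 refl (suc n C k) (n ∸ k) (k !) ((n ∸ k) !) ⟩
    (suc n C k) * (k ! * suc (n ∸ k) !)            ≡⟨ cong (λ z → (suc n C k) * (k ! * z !)) (+-∸-assoc 1 k≤n) ⟨
    (suc n C k) * (k ! * (suc n ∸ k) !)            ≡⟨ nCk*[k!*[n∸k]!]≡n! (m≤n⇒m≤1+n k≤n) ⟩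
    suc n !                                        ≡⟨ *-comm (suc n) (n !) ⟩
    n ! * suc n                                    ≡⟨ cong (_* suc n) (nCk*[k!*[n∸k]!]≡n! k≤n) ⟨
    (n C k) * (k ! * (n ∸ k) !) * suc n            ≡⟨ solve 3 (λ A x n → (A :* x) :* (con 1 :+ n) := (A :* (con 1 :+ n)) :* x)
                                                            refl (n C k) (k ! * (n ∸ k) !) n ⟩
    (n C k) * suc n * (k ! * (n ∸ k) !) ∎)
    where instance _ = m*n≢0 (k !) ((n ∸ k) !) {{k !≢0}} {{(n ∸ k) !≢0}}

  nCk*[1+n]≡[1+n]C[1+k]*[1+k] : ∀ {n k} → k ≤ n → (n C k) * suc n ≡ (suc n C suc k) * suc k
  nCk*[1+n]≡[1+n]C[1+k]*[1+k] {n} {k} k≤n = *-cancelʳ-≡ _ _ (k ! * (n ∸ k) !) (begin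
    (n C k) * suc n * (k ! * (n ∸ k) !)    ≡⟨ solve 3 (λ A x n → (A :* (con 1 :+ n)) :* x := (A :* x) :* (con 1 :+ n))
                                                    refl (n C k) (k ! * (n ∸ k) !) n ⟩
    (n C k) * (k ! * (n ∸ k) !) * suc n    ≡⟨ cong (_* suc n) (nCk*[k!*[n∸k]!]≡n! k≤n) ⟩
    n ! * suc n                            ≡⟨ *-comm (n !) (suc n) ⟩
    suc n !                                ≡⟨ nCk*[k!*[n∸k]!]≡n! (s≤s k≤n) ⟨
    (suc n C suc k) * (suc k ! * (n ∸ k) !)
      ≡⟨ solve 4 (λ B k x y → B :* ((x :+ k :* x) :* y) := (B :* (con 1 :+ k)) :* (x :* y))
                 refl (suc n C suc k) k (k !) ((n ∸ k) !) ⟩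
    (suc n C suc k) * suc k * (k ! * (n ∸ k) !) ∎)
    where instance _ = m*n≢0 (k !) ((n ∸ k) !) {{k !≢0}} {{(n ∸ k) !≢0}}

  [1+n]Cn≡1+n : ∀ n → suc n C n ≡ suc n
  [1+n]Cn≡1+n n = trans (nCk≡nC[n∸k] (n≤1+n n)) (trans (cong (suc n C_) (m+n∸n≡m 1 n)) (nC1≡n (suc n)))

  [a+[N∸b]]%N≡0⇒a≡b : ∀ {N a b} .{{_ : NonZero N}} → a < N → b < N → (a + (N ∸ b)) % N ≡ 0 → a ≡ b
  [a+[N∸b]]%N≡0⇒a≡b {N} {a} {b} a<N b<N ≡0 with ≤-<-connex b a
  ... | inj₁ b≤a = ≤-antisym (m∸n≡0⇒m≤n (trans (sym reduce) ≡0)) b≤a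
    where
    shift : a + (N ∸ b) ≡ (a ∸ b) + N
    shift = begin
      a + (N ∸ b)              ≡⟨ cong (_+ (N ∸ b)) (m∸n+n≡m b≤a) ⟨
      (a ∸ b + b) + (N ∸ b)    ≡⟨ +-assoc (a ∸ b) b (N ∸ b) ⟩
      (a ∸ b) + (b + (N ∸ b))  ≡⟨ cong ((a ∸ b) +_) (m+[n∸m]≡n (<⇒≤ b<N)) ⟩
      (a ∸ b) + N              ∎
    reduce : (a + (N ∸ b)) % N ≡ a ∸ b
    reduce = trans (cong (_% N) shift) (trans ([m+n]%n≡m%n (a ∸ b) N) (m<n⇒m%n≡m (≤-<-trans (m∸n≤m a b) a<N)))
  ... | inj₂ a<b = ⊥-elim (<⇒≱ b<N (m∸n≡0⇒m≤n (m+n≡0⇒n≡0 a (trans (sym (m<n⇒m%n≡m small)) ≡0))))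
    where
    small : a + (N ∸ b) < N
    small = subst (a + (N ∸ b) <_) (m+[n∸m]≡n (<⇒≤ b<N)) (+-monoˡ-< (N ∸ b) a<b)

  b+[a+[N∸b]]≡a+N : ∀ {N a b} → b ≤ N → b + (a + (N ∸ b)) ≡ a + N
  b+[a+[N∸b]]≡a+N {N} {a} {b} b≤N = trans (solve 3 (λ a b p → b :+ (a :+ p) := a :+ (b :+ p)) refl a b (N ∸ b)) (cong (a +_) (m+[n∸m]≡n b≤N))

  [a+[N∸b]]+[b+[N∸a]]≡N+N : ∀ {N a b} → a ≤ N → b ≤ N → (a + (N ∸ b)) + (b + (N ∸ a)) ≡ N + N
  [a+[N∸b]]+[b+[N∸a]]≡N+N {N} {a} {b} a≤N b≤N =
    trans (solve 4 (λ a p b q → (a :+ p) :+ (b :+ q) := (a :+ q) :+ (b :+ p)) refl a (N ∸ b) b (N ∸ a)) (cong₂ _+_ (m+[n∸m]≡n a≤N) (m+[n∸m]≡n b≤N))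

open ℕ-Lemmas

-- The ring solver needs coefficients with decidable equality; ℤ maps into every commutative ring.
module IntegerRingSolver {c ℓ : Level} (R : CommutativeRing c ℓ) where
  open import Data.Integer as ℤ using (ℤ; +_; -[1+_]; _◃_; sign; ∣_∣)
  import Data.Integer.Properties as ℤ
  open import Data.Sign as Sign using (Sign)
  open import Data.Maybe using (Maybe; just; nothing)
  open import Algebra.Solver.Ring.AlmostCommutativeRing using (_-Raw-AlmostCommutative⟶_; fromCommutativeRing)
  open CommutativeRing R
  open RingOps R
  open import Algebra.Properties.Ring ring using (-‿distribʳ-*; -‿involutive; -‿+-comm; -0#≈0#; -1*x≈-x)
  open import Relation.Binary.Reasoning.Setoid setoid

  fromℕ-+ : ∀ m n → fromℕ (m ℕ.+ n) ≈ fromℕ m + fromℕ n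
  fromℕ-+ zero    n = sym (+-identityˡ _)
  fromℕ-+ (suc m) n = trans (+-congˡ (fromℕ-+ m n)) (sym (+-assoc _ _ _))

  fromℕ-* : ∀ m n → fromℕ (m ℕ.* n) ≈ fromℕ m * fromℕ n
  fromℕ-* zero    n = sym (zeroˡ _)
  fromℕ-* (suc m) n = begin
    fromℕ (n ℕ.+ m ℕ.* n)             ≈⟨ fromℕ-+ n (m ℕ.* n) ⟩
    fromℕ n + fromℕ (m ℕ.* n)         ≈⟨ +-cong (sym (*-identityˡ _)) (fromℕ-* m n) ⟩
    1# * fromℕ n + fromℕ m * fromℕ n  ≈⟨ distribʳ _ _ _ ⟨
    (1# + fromℕ m) * fromℕ n          ∎

  fromℕ-∸ : ∀ {m n} → n ℕ.≤ m → fromℕ (m ℕ.∸ n) ≈ fromℕ m - fromℕ n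
  fromℕ-∸ {m} {n} n≤m = begin
    fromℕ (m ℕ.∸ n)                           ≈⟨ +-identityʳ _ ⟨
    fromℕ (m ℕ.∸ n) + 0#                      ≈⟨ +-congˡ (-‿inverseʳ (fromℕ n)) ⟨
    fromℕ (m ℕ.∸ n) + (fromℕ n - fromℕ n)     ≈⟨ +-assoc _ _ _ ⟨
    (fromℕ (m ℕ.∸ n) + fromℕ n) - fromℕ n     ≈⟨ +-congʳ (fromℕ-+ (m ℕ.∸ n) n) ⟨
    fromℕ (m ℕ.∸ n ℕ.+ n) - fromℕ n           ≡⟨ P.cong (λ k → fromℕ k - fromℕ n) (ℕ.m∸n+n≡m n≤m) ⟩
    fromℕ m - fromℕ n                         ∎

  fromℤ : ℤ → Carrier
  fromℤ (+ n)    = fromℕ n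
  fromℤ -[1+ n ] = - fromℕ (suc n)

  fromℤ-neg : ∀ i → fromℤ (ℤ.- i) ≈ - fromℤ i
  fromℤ-neg -[1+ n ]    = sym (-‿involutive _)
  fromℤ-neg (+ zero)    = sym -0#≈0#
  fromℤ-neg (+ suc n)   = refl

  fromℤ-⊖ : ∀ m n → fromℤ (m ℤ.⊖ n) ≈ fromℕ m - fromℕ n
  fromℤ-⊖ m n with ℕ.≤-<-connex n m
  ... | inj₁ n≤m rewrite ℤ.⊖-≥ n≤m = fromℕ-∸ n≤m
  ... | inj₂ m<n rewrite ℤ.⊖-< m<n = begin
    fromℤ (ℤ.- (+ (n ℕ.∸ m)))   ≈⟨ fromℤ-neg (+ (n ℕ.∸ m)) ⟩
    - fromℕ (n ℕ.∸ m)           ≈⟨ -‿cong (fromℕ-∸ (ℕ.<⇒≤ m<n)) ⟩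
    - (fromℕ n - fromℕ m)       ≈⟨ -‿anti-homo-- ⟩
    fromℕ m - fromℕ n           ∎
    where
    -‿anti-homo-- : - (fromℕ n - fromℕ m) ≈ fromℕ m - fromℕ n
    -‿anti-homo-- = trans (sym (-‿+-comm _ _)) (trans (+-congˡ (-‿involutive _)) (+-comm _ _))

  fromℤ-+ : ∀ i j → fromℤ (i ℤ.+ j) ≈ fromℤ i + fromℤ j
  fromℤ-+ -[1+ m ] -[1+ n ] = begin
    - fromℕ (suc (suc (m ℕ.+ n)))    ≡⟨ P.cong (λ k → - fromℕ (suc k)) (P.sym (ℕ.+-suc m n)) ⟩
    - fromℕ (suc m ℕ.+ suc n)        ≈⟨ -‿cong (fromℕ-+ (suc m) (suc n)) ⟩
    - (fromℕ (suc m) + fromℕ (suc n)) ≈⟨ -‿+-comm _ _ ⟨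
    - fromℕ (suc m) - fromℕ (suc n)  ∎
  fromℤ-+ -[1+ m ] (+ n)    = trans (fromℤ-⊖ n (suc m)) (+-comm _ _)
  fromℤ-+ (+ m)    -[1+ n ] = fromℤ-⊖ m (suc n)
  fromℤ-+ (+ m)    (+ n)    = fromℕ-+ m n

  fromSign : Sign → Carrier
  fromSign Sign.+ = 1#
  fromSign Sign.- = - 1#

  fromℤ-◃ : ∀ s n → fromℤ (s ◃ n) ≈ fromSign s * fromℕ n
  fromℤ-◃ s      zero    = sym (zeroʳ _)
  fromℤ-◃ Sign.+ (suc n) = sym (*-identityˡ _)
  fromℤ-◃ Sign.- (suc n) = sym (-1*x≈-x _)

  fromℤ-sign-abs : ∀ i → fromℤ i ≈ fromSign (sign i) * fromℕ ∣ i ∣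
  fromℤ-sign-abs i = trans (reflexive (P.cong fromℤ (P.sym (ℤ.◃-inverse i)))) (fromℤ-◃ (sign i) ∣ i ∣)

  fromSign-* : ∀ s t → fromSign (s Sign.* t) ≈ fromSign s * fromSign t
  fromSign-* Sign.+ t      = sym (*-identityˡ _)
  fromSign-* Sign.- Sign.+ = sym (*-identityʳ _)
  fromSign-* Sign.- Sign.- = begin
    1#          ≈⟨ -‿involutive 1# ⟨
    - - 1#      ≈⟨ -‿cong (-1*x≈-x 1#) ⟨
    - (- 1# * 1#) ≈⟨ -‿distribʳ-* _ _ ⟩
    - 1# * - 1# ∎

  fromℤ-* : ∀ i j → fromℤ (i ℤ.* j) ≈ fromℤ i * fromℤ j
  fromℤ-* i j = begin
    fromℤ (i ℤ.* j)                                                ≈⟨ fromℤ-◃ (sign i Sign.* sign j) (∣ i ∣ ℕ.* ∣ j ∣) ⟩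
    fromSign (sign i Sign.* sign j) * fromℕ (∣ i ∣ ℕ.* ∣ j ∣)       ≈⟨ *-cong (fromSign-* (sign i) (sign j)) (fromℕ-* ∣ i ∣ ∣ j ∣) ⟩
    (fromSign (sign i) * fromSign (sign j)) * (fromℕ ∣ i ∣ * fromℕ ∣ j ∣) ≈⟨ interchange _ _ _ _ ⟩
    (fromSign (sign i) * fromℕ ∣ i ∣) * (fromSign (sign j) * fromℕ ∣ j ∣) ≈⟨ *-cong (fromℤ-sign-abs i) (fromℤ-sign-abs j) ⟨
    fromℤ i * fromℤ j                                              ∎
    where
    interchange : ∀ a b x y → (a * b) * (x * y) ≈ (a * x) * (b * y)
    interchange a b x y = begin
      (a * b) * (x * y)  ≈⟨ *-assoc _ _ _ ⟩
      a * (b * (x * y))  ≈⟨ *-congˡ (trans (sym (*-assoc _ _ _)) (trans (*-congʳ (*-comm b x)) (*-assoc _ _ _))) ⟩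
      a * (x * (b * y))  ≈⟨ *-assoc _ _ _ ⟨
      (a * x) * (b * y)  ∎

  fromℤ-homomorphism : ℤ.+-*-rawRing -Raw-AlmostCommutative⟶ fromCommutativeRing R
  fromℤ-homomorphism = record
    { ⟦_⟧    = fromℤ
    ; +-homo = fromℤ-+
    ; *-homo = fromℤ-*
    ; -‿homo = fromℤ-neg
    ; 0-homo = refl
    ; 1-homo = +-identityʳ 1#
    }

  fromℤ-≟ : ∀ i j → Maybe (fromℤ i ≈ fromℤ j)
  fromℤ-≟ i j with i ℤ.≟ j
  ... | yes P.refl = just refl
  ... | no _       = nothing

  open import Algebra.Solver.Ring ℤ.+-*-rawRing (fromCommutativeRing R) fromℤ-homomorphism fromℤ-≟ public
    using (solve; _:=_; _:+_; _:*_; _:-_; :-_)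

module Lemmas {c ℓ} (F : CharZeroField c ℓ) where
  open WithField F
  open IntegerRingSolver commRing public using (fromℕ-+; fromℕ-*; solve; _:=_; _:+_; _:*_; _:-_; :-_)
  open import Algebra.Properties.Ring ring using (-1*x≈-x; -‿distribʳ-*; -‿+-comm; -0#≈0#)
  open import Relation.Binary.Reasoning.Setoid setoid

  fromℕ-1 : fromℕ 1 ≈ 1#
  fromℕ-1 = +-identityʳ 1#

  pow-cong : ∀ {x y} n → x ≈ y → pow x n ≈ pow y n
  pow-cong zero    x≈y = refl
  pow-cong (suc n) x≈y = *-cong x≈y (pow-cong n x≈y)

  pow-+ : ∀ x m n → pow x (m +ℕ n) ≈ pow x m * pow x n
  pow-+ x zero    n = sym (*-identityˡ _)
  pow-+ x (suc m) n = trans (*-congˡ (pow-+ x m n)) (sym (*-assoc _ _ _))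

  pow-distrib-* : ∀ x y n → pow (x * y) n ≈ pow x n * pow y n
  pow-distrib-* x y zero    = sym (*-identityˡ _)
  pow-distrib-* x y (suc n) = trans (*-congˡ (pow-distrib-* x y n))
    (solve 4 (λ x y a b → (x :* y) :* (a :* b) := (x :* a) :* (y :* b)) refl x y (pow x n) (pow y n))

  pow-* : ∀ x m n → pow x (m *ℕ n) ≈ pow (pow x m) n
  pow-* x m zero    = reflexive (P.cong (pow x) (ℕ.*-zeroʳ m))
  pow-* x m (suc n) = begin
    pow x (m *ℕ suc n)           ≡⟨ P.cong (pow x) (ℕ.*-suc m n) ⟩
    pow x (m +ℕ m *ℕ n)          ≈⟨ pow-+ x m (m *ℕ n) ⟩
    pow x m * pow x (m *ℕ n)     ≈⟨ *-congˡ (pow-* x m n) ⟩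
    pow x m * pow (pow x m) n    ∎

  pow-1# : ∀ n → pow 1# n ≈ 1#
  pow-1# zero    = refl
  pow-1# (suc n) = trans (*-identityˡ _) (pow-1# n)

  sgn : ℕ → Carrier
  sgn = pow (- 1#)

  sgn-suc : ∀ n → sgn (suc n) ≈ - sgn n
  sgn-suc n = -1*x≈-x (sgn n)

  sgn-+ : ∀ m n → sgn (m +ℕ n) ≈ sgn m * sgn n
  sgn-+ = pow-+ (- 1#)

  sgn*sgn : ∀ n → sgn n * sgn n ≈ 1#
  sgn*sgn zero    = *-identityˡ 1#
  sgn*sgn (suc n) = begin
    sgn (suc n) * sgn (suc n) ≈⟨ *-cong (sgn-suc n) (sgn-suc n) ⟩
    - sgn n * - sgn n         ≈⟨ solve 1 (λ s → (:- s) :* (:- s) := s :* s) refl (sgn n) ⟩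
    sgn n * sgn n             ≈⟨ sgn*sgn n ⟩
    1#                        ∎

  δℕ-refl : ∀ m → δℕ m m ≈ 1#
  δℕ-refl m with m ≟ m
  ... | yes _ = refl
  ... | no m≢m = ⊥-elim (m≢m P.refl)

  δℕ-≢ : ∀ {m n} → ¬ m ≡ n → δℕ m n ≈ 0#
  δℕ-≢ {m} {n} m≢n with m ≟ n
  ... | yes m≡n = ⊥-elim (m≢n m≡n)
  ... | no _ = refl

  *-cancelˡ-unit : ∀ {u v} x y → v * u ≈ 1# → u * x ≈ u * y → x ≈ y
  *-cancelˡ-unit {u} {v} x y vu≈1 ux≈uy = begin
    x            ≈⟨ *-identityˡ x ⟨
    1# * x       ≈⟨ *-congʳ vu≈1 ⟨
    (v * u) * x  ≈⟨ *-assoc _ _ _ ⟩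
    v * (u * x)  ≈⟨ *-congˡ ux≈uy ⟩
    v * (u * y)  ≈⟨ *-assoc _ _ _ ⟨
    (v * u) * y  ≈⟨ *-congʳ vu≈1 ⟩
    1# * y       ≈⟨ *-identityˡ y ⟩
    y            ∎

  fromℕ-≉0 : ∀ k .{{_ : NonZero k}} → ¬ fromℕ k ≈ 0#
  fromℕ-≉0 (suc k) = charZero k

  fromℕ*invℕ : ∀ k .{{_ : NonZero k}} → fromℕ k * invℕ k ≈ 1#
  fromℕ*invℕ k = inverse (fromℕ k) (fromℕ-≉0 k)

  invℕ*fromℕ : ∀ k .{{_ : NonZero k}} → invℕ k * fromℕ k ≈ 1#
  invℕ*fromℕ k = trans (*-comm _ _) (fromℕ*invℕ k)

  fromℕ-cancelˡ : ∀ k .{{_ : NonZero k}} x y → fromℕ k * x ≈ fromℕ k * y → x ≈ y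
  fromℕ-cancelˡ k x y = *-cancelˡ-unit x y (invℕ*fromℕ k)

  invℕ-unique : ∀ k .{{_ : NonZero k}} y → fromℕ k * y ≈ 1# → y ≈ invℕ k
  invℕ-unique k y ky≈1 = fromℕ-cancelˡ k y _ (trans ky≈1 (sym (fromℕ*invℕ k)))

  *-cancelˡ-≉0 : ∀ {x} y → ¬ x ≈ 0# → x * y ≈ 0# → y ≈ 0#
  *-cancelˡ-≉0 {x} y x≉0 xy≈0 = *-cancelˡ-unit y 0# (trans (*-comm _ _) (inverse x x≉0)) (trans xy≈0 (sym (zeroʳ x)))

  -- Finite sums

  sum1-cong-≤ : ∀ n {f g : ℕ → Carrier} → (∀ i → 1 ≤ i → i ≤ n → f i ≈ g i) → sum1 n f ≈ sum1 n g
  sum1-cong-≤ zero    f≈g = refl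
  sum1-cong-≤ (suc n) f≈g =
    +-cong (sum1-cong-≤ n (λ i 1≤i i≤n → f≈g i 1≤i (ℕ.m≤n⇒m≤1+n i≤n))) (f≈g (suc n) (s≤s z≤n) ℕ.≤-refl)

  sum1-cong : ∀ n {f g : ℕ → Carrier} → (∀ i → f i ≈ g i) → sum1 n f ≈ sum1 n g
  sum1-cong n f≈g = sum1-cong-≤ n (λ i _ _ → f≈g i)

  sum1-≈0 : ∀ n {f : ℕ → Carrier} → (∀ i → 1 ≤ i → i ≤ n → f i ≈ 0#) → sum1 n f ≈ 0#
  sum1-≈0 zero    f≈0 = refl
  sum1-≈0 (suc n) f≈0 = trans (+-cong (sum1-≈0 n (λ i 1≤i i≤n → f≈0 i 1≤i (ℕ.m≤n⇒m≤1+n i≤n)))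
                                      (f≈0 (suc n) (s≤s z≤n) ℕ.≤-refl))
                              (+-identityˡ _)

  sum1-+ : ∀ n (f g : ℕ → Carrier) → sum1 n (λ i → f i + g i) ≈ sum1 n f + sum1 n g
  sum1-+ zero    f g = sym (+-identityˡ _)
  sum1-+ (suc n) f g = trans (+-congʳ (sum1-+ n f g))
    (solve 4 (λ a b c d → (a :+ b) :+ (c :+ d) := (a :+ c) :+ (b :+ d)) refl _ _ _ _)

  *-distribˡ-sum1 : ∀ n x (f : ℕ → Carrier) → x * sum1 n f ≈ sum1 n (λ i → x * f i)
  *-distribˡ-sum1 zero    x f = zeroʳ x
  *-distribˡ-sum1 (suc n) x f = trans (distribˡ _ _ _) (+-congʳ (*-distribˡ-sum1 n x f))

  *-distribʳ-sum1 : ∀ n x (f : ℕ → Carrier) → sum1 n f * x ≈ sum1 n (λ i → f i * x)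
  *-distribʳ-sum1 n x f = trans (*-comm _ _) (trans (*-distribˡ-sum1 n x f) (sum1-cong n (λ i → *-comm _ _)))

  -‿sum1 : ∀ n (f : ℕ → Carrier) → - sum1 n f ≈ sum1 n (λ i → - f i)
  -‿sum1 zero    f = -0#≈0#
  -‿sum1 (suc n) f = trans (sym (-‿+-comm _ _)) (+-congʳ (-‿sum1 n f))

  sum1-comm : ∀ n m (f : ℕ → ℕ → Carrier) →
    sum1 n (λ i → sum1 m (λ j → f i j)) ≈ sum1 m (λ j → sum1 n (λ i → f i j))
  sum1-comm zero    m f = sym (sum1-≈0 m (λ _ _ _ → refl))
  sum1-comm (suc n) m f = begin
    sum1 n (λ i → sum1 m (f i)) + sum1 m (f (suc n))      ≈⟨ +-congʳ (sum1-comm n m f) ⟩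
    sum1 m (λ j → sum1 n (λ i → f i j)) + sum1 m (f (suc n)) ≈⟨ sum1-+ m _ _ ⟨
    sum1 m (λ j → sum1 (suc n) (λ i → f i j))             ∎

  sum1-extend : ∀ n m {f : ℕ → Carrier} → n ≤ m → (∀ i → n < i → i ≤ m → f i ≈ 0#) → sum1 m f ≈ sum1 n f
  sum1-extend n zero    z≤n  _   = refl
  sum1-extend n (suc m) n≤1+m f≈0 with ℕ.m≤n⇒m<n∨m≡n n≤1+m
  ... | inj₂ P.refl = refl
  ... | inj₁ n<1+m  = trans (+-cong (sum1-extend n m (ℕ.≤-pred n<1+m) (λ i n<i i≤m → f≈0 i n<i (ℕ.m≤n⇒m≤1+n i≤m)))
                                    (f≈0 (suc m) n<1+m ℕ.≤-refl))
                            (+-identityʳ _)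

  sum1-single : ∀ n k {f : ℕ → Carrier} → 1 ≤ k → k ≤ n →
    (∀ i → 1 ≤ i → i ≤ n → ¬ i ≡ k → f i ≈ 0#) → sum1 n f ≈ f k
  sum1-single zero    (suc _) _ () _
  sum1-single (suc n) k 1≤k k≤1+n f≈0 with ℕ.m≤n⇒m<n∨m≡n k≤1+n
  ... | inj₂ P.refl = trans (+-congʳ (sum1-≈0 n (λ i 1≤i i≤n → f≈0 i 1≤i (ℕ.m≤n⇒m≤1+n i≤n) (ℕ.<⇒≢ (s≤s i≤n)))))
                            (+-identityˡ _)
  ... | inj₁ k<1+n  = trans (+-cong (sum1-single n k 1≤k (ℕ.≤-pred k<1+n) (λ i 1≤i i≤n → f≈0 i 1≤i (ℕ.m≤n⇒m≤1+n i≤n)))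
                                    (f≈0 (suc n) (s≤s z≤n) ℕ.≤-refl (ℕ.>⇒≢ k<1+n)))
                            (+-identityʳ _)

  sum0-cong-≤ : ∀ n {f g : ℕ → Carrier} → (∀ i → i ≤ n → f i ≈ g i) → sum0 n f ≈ sum0 n g
  sum0-cong-≤ n f≈g = +-cong (f≈g 0 z≤n) (sum1-cong-≤ n (λ i _ i≤n → f≈g i i≤n))

  sum0-cong : ∀ n {f g : ℕ → Carrier} → (∀ i → f i ≈ g i) → sum0 n f ≈ sum0 n g
  sum0-cong n f≈g = +-cong (f≈g 0) (sum1-cong n f≈g)

  sum0-≈0 : ∀ n {f : ℕ → Carrier} → (∀ i → i ≤ n → f i ≈ 0#) → sum0 n f ≈ 0#
  sum0-≈0 n f≈0 = trans (+-cong (f≈0 0 z≤n) (sum1-≈0 n (λ i _ i≤n → f≈0 i i≤n))) (+-identityˡ _)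

  sum0-+ : ∀ n (f g : ℕ → Carrier) → sum0 n (λ i → f i + g i) ≈ sum0 n f + sum0 n g
  sum0-+ n f g = trans (+-congˡ (sum1-+ n f g))
    (solve 4 (λ a b c d → (a :+ b) :+ (c :+ d) := (a :+ c) :+ (b :+ d)) refl _ _ _ _)

  *-distribˡ-sum0 : ∀ n x (f : ℕ → Carrier) → x * sum0 n f ≈ sum0 n (λ i → x * f i)
  *-distribˡ-sum0 n x f = trans (distribˡ _ _ _) (+-congˡ (*-distribˡ-sum1 n x f))

  *-distribʳ-sum0 : ∀ n x (f : ℕ → Carrier) → sum0 n f * x ≈ sum0 n (λ i → f i * x)
  *-distribʳ-sum0 n x f = trans (*-comm _ _) (trans (*-distribˡ-sum0 n x f) (sum0-cong n (λ i → *-comm _ _)))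

  -‿sum0 : ∀ n (f : ℕ → Carrier) → - sum0 n f ≈ sum0 n (λ i → - f i)
  -‿sum0 n f = trans (sym (-‿+-comm _ _)) (+-congˡ (-‿sum1 n f))

  sum0-- : ∀ n (f g : ℕ → Carrier) → sum0 n (λ i → f i - g i) ≈ sum0 n f - sum0 n g
  sum0-- n f g = trans (sum0-+ n f _) (+-congˡ (sym (-‿sum0 n g)))

  sum0-sucʳ : ∀ n (f : ℕ → Carrier) → sum0 (suc n) f ≈ sum0 n f + f (suc n)
  sum0-sucʳ n f = sym (+-assoc _ _ _)

  sum1-suc≈sum0 : ∀ n (f : ℕ → Carrier) → sum1 (suc n) f ≈ sum0 n (λ i → f (suc i))
  sum1-suc≈sum0 zero    f = trans (+-identityˡ _) (sym (+-identityʳ _))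
  sum1-suc≈sum0 (suc n) f = trans (+-congʳ (sum1-suc≈sum0 n f)) (+-assoc _ _ _)

  sum0-sucˡ : ∀ n (f : ℕ → Carrier) → sum0 (suc n) f ≈ f 0 + sum0 n (λ i → f (suc i))
  sum0-sucˡ n f = +-congˡ (sum1-suc≈sum0 n f)

  sum0-reverse : ∀ n (f : ℕ → Carrier) → sum0 n f ≈ sum0 n (λ l → f (n ∸ l))
  sum0-reverse zero    f = refl
  sum0-reverse (suc n) f = begin
    sum0 (suc n) f                          ≈⟨ sum0-sucʳ n f ⟩
    sum0 n f + f (suc n)                    ≈⟨ +-comm _ _ ⟩
    f (suc n) + sum0 n f                    ≈⟨ +-congˡ (sum0-reverse n f) ⟩
    f (suc n) + sum0 n (λ l → f (n ∸ l))    ≈⟨ sum0-sucˡ n _ ⟨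
    sum0 (suc n) (λ l → f (suc n ∸ l))      ∎

  sum0-single : ∀ n k {f : ℕ → Carrier} → k ≤ n →
    (∀ i → i ≤ n → ¬ i ≡ k → f i ≈ 0#) → sum0 n f ≈ f k
  sum0-single n zero    _   f≈0 =
    trans (+-congˡ (sum1-≈0 n (λ { (suc i) _ i≤n → f≈0 (suc i) i≤n (λ ()) }))) (+-identityʳ _)
  sum0-single n (suc k) k≤n f≈0 =
    trans (+-congʳ (f≈0 0 z≤n (λ ())))
          (trans (+-identityˡ _) (sum1-single n (suc k) (s≤s z≤n) k≤n (λ i _ i≤n → f≈0 i i≤n)))

  sum< : ℕ → (ℕ → Carrier) → Carrier
  sum< zero    f = 0#
  sum< (suc m) f = sum< m f + f m

  sum<-cong-< : ∀ m {f g : ℕ → Carrier} → (∀ v → v < m → f v ≈ g v) → sum< m f ≈ sum< m g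
  sum<-cong-< zero    f≈g = refl
  sum<-cong-< (suc m) f≈g = +-cong (sum<-cong-< m (λ v v<m → f≈g v (ℕ.m≤n⇒m≤1+n v<m))) (f≈g m ℕ.≤-refl)

  *-distribˡ-sum< : ∀ m x (f : ℕ → Carrier) → x * sum< m f ≈ sum< m (λ v → x * f v)
  *-distribˡ-sum< zero    x f = zeroʳ x
  *-distribˡ-sum< (suc m) x f = trans (distribˡ _ _ _) (+-congʳ (*-distribˡ-sum< m x f))

  sum<-- : ∀ m (f g : ℕ → Carrier) → sum< m (λ v → f v - g v) ≈ sum< m f - sum< m g
  sum<-- zero    f g = sym (trans (+-congˡ -0#≈0#) (+-identityʳ _))
  sum<-- (suc m) f g = trans (+-congʳ (sum<-- m f g))
    (solve 4 (λ a b c d → (a :- b) :+ (c :- d) := (a :+ c) :- (b :+ d)) refl _ _ _ _)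

  sum<-suc≈sum0 : ∀ k (f : ℕ → Carrier) → sum< (suc k) f ≈ sum0 k f
  sum<-suc≈sum0 zero    f = +-comm _ _
  sum<-suc≈sum0 (suc k) f = trans (+-congʳ (sum<-suc≈sum0 k f)) (sym (sum0-sucʳ k f))

  sum0-δℕ-0 : ∀ n (f : ℕ → Carrier) → sum0 n (λ k → δℕ k 0 * f k) ≈ f 0
  sum0-δℕ-0 n f = trans (sum0-single n 0 z≤n (λ i _ i≢0 → trans (*-congʳ (δℕ-≢ i≢0)) (zeroˡ _)))
                        (trans (*-congʳ (δℕ-refl 0)) (*-identityˡ _))

  sum0-δℕ-∸ : ∀ n (f : ℕ → Carrier) → sum0 n (λ k → δℕ (n ∸ k) 0 * f k) ≈ f n
  sum0-δℕ-∸ n f = trans (sum0-single n n ℕ.≤-refl (λ i i≤n i≢n → trans (*-congʳ (δℕ-≢ (ℕ.m>n⇒m∸n≢0 (ℕ.≤∧≢⇒< i≤n i≢n)))) (zeroˡ _)))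
                        (trans (*-congʳ (trans (reflexive (P.cong (λ z → δℕ z 0) (ℕ.n∸n≡0 n))) (δℕ-refl 0))) (*-identityˡ _))

  -- Factorials and binomial coefficients in F

  invℕ-* : ∀ m n .{{_ : NonZero m}} .{{_ : NonZero n}} → invℕ (m *ℕ n) ≈ invℕ m * invℕ n
  invℕ-* m n = sym (invℕ-unique (m *ℕ n) {{ℕ.m*n≢0 m n}} _ (begin
    fromℕ (m *ℕ n) * (invℕ m * invℕ n)          ≈⟨ *-congʳ (fromℕ-* m n) ⟩
    (fromℕ m * fromℕ n) * (invℕ m * invℕ n)     ≈⟨ solve 4 (λ a b x y → (a :* b) :* (x :* y) := (a :* x) :* (b :* y)) refl _ _ _ _ ⟩
    (fromℕ m * invℕ m) * (fromℕ n * invℕ n)     ≈⟨ *-cong (fromℕ*invℕ m) (fromℕ*invℕ n) ⟩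
    1# * 1#                                     ≈⟨ *-identityˡ 1# ⟩
    1#                                          ∎))

  fraction-≈ : ∀ a b c d .{{_ : NonZero b}} .{{_ : NonZero d}} →
    a *ℕ d ≡ c *ℕ b → fromℕ a * invℕ b ≈ fromℕ c * invℕ d
  fraction-≈ a b c d ad≡cb = *-cancelˡ-unit _ _ inverse-bd (begin
    (fromℕ b * fromℕ d) * (fromℕ a * invℕ b)    ≈⟨ solve 4 (λ b d a ib → (b :* d) :* (a :* ib) := (a :* d) :* (b :* ib)) refl _ _ _ _ ⟩
    (fromℕ a * fromℕ d) * (fromℕ b * invℕ b)    ≈⟨ *-cong (sym (fromℕ-* a d)) (fromℕ*invℕ b) ⟩
    fromℕ (a *ℕ d) * 1#                         ≡⟨ P.cong (λ k → fromℕ k * 1#) ad≡cb ⟩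
    fromℕ (c *ℕ b) * 1#                         ≈⟨ *-cong (sym (fromℕ-* c b)) (fromℕ*invℕ d) ⟨
    (fromℕ c * fromℕ b) * (fromℕ d * invℕ d)    ≈⟨ solve 4 (λ c b d id → (c :* b) :* (d :* id) := (b :* d) :* (c :* id)) refl _ _ _ _ ⟩
    (fromℕ b * fromℕ d) * (fromℕ c * invℕ d)    ∎)
    where
    inverse-bd : (invℕ b * invℕ d) * (fromℕ b * fromℕ d) ≈ 1#
    inverse-bd = begin
      (invℕ b * invℕ d) * (fromℕ b * fromℕ d)   ≈⟨ solve 4 (λ a b x y → (a :* b) :* (x :* y) := (a :* x) :* (b :* y)) refl _ _ _ _ ⟩
      (invℕ b * fromℕ b) * (invℕ d * fromℕ d)   ≈⟨ *-cong (invℕ*fromℕ b) (invℕ*fromℕ d) ⟩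
      1# * 1#                                   ≈⟨ *-identityˡ 1# ⟩
      1#                                        ∎

  invFact : ℕ → Carrier
  invFact n = invℕ (n !)

  invSuc : ℕ → Carrier
  invSuc n = invℕ (suc n)

  choose : ℕ → ℕ → Carrier
  choose n k = fromℕ (n C k)

  fromℕ-fact*invFact : ∀ n → fromℕ (n !) * invFact n ≈ 1#
  fromℕ-fact*invFact n = fromℕ*invℕ (n !) {{n !≢0}}

  invFact*fromℕ-fact : ∀ n → invFact n * fromℕ (n !) ≈ 1#
  invFact*fromℕ-fact n = invℕ*fromℕ (n !) {{n !≢0}}

  one*-invℕ : ∀ n .{{_ : NonZero n}} → fromℕ 1 * invℕ n ≈ invℕ n
  one*-invℕ n = trans (*-congʳ fromℕ-1) (*-identityˡ _)

  invFact-0 : invFact 0 ≈ 1#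
  invFact-0 = sym (invℕ-unique 1 1# (trans (*-identityʳ _) fromℕ-1))

  invFact-suc : ∀ n → invFact n ≈ fromℕ (suc n) * invFact (suc n)
  invFact-suc n = trans (sym (one*-invℕ (n !) {{n !≢0}}))
    (fraction-≈ 1 (n !) (suc n) (suc n !) {{n !≢0}} {{suc n !≢0}} (ℕ.+-identityʳ (suc n !)))

  fromℕ-fact*invFact-suc : ∀ n → fromℕ (n !) * invFact (suc n) ≈ invSuc n
  fromℕ-fact*invFact-suc n = trans
    (fraction-≈ (n !) (suc n !) 1 (suc n) {{suc n !≢0}} (P.trans (ℕ.*-comm (n !) (suc n)) (P.sym (ℕ.+-identityʳ (suc n !)))))
    (one*-invℕ (suc n))

  choose*invFact : ∀ {n k} → k ≤ n → choose n k * invFact n ≈ invFact k * invFact (n ∸ k)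
  choose*invFact {n} {k} k≤n = begin
    choose n k * invFact n               ≈⟨ fraction-≈ (n C k) (n !) 1 (k ! *ℕ (n ∸ k) !) {{n !≢0}} {{k !* (n ∸ k) !≢0}}
                                              (P.trans (nCk*[k!*[n∸k]!]≡n! k≤n) (P.sym (ℕ.+-identityʳ (n !)))) ⟩
    fromℕ 1 * invℕ (k ! *ℕ (n ∸ k) !)    ≈⟨ one*-invℕ _ {{k !* (n ∸ k) !≢0}} ⟩
    invℕ (k ! *ℕ (n ∸ k) !)              ≈⟨ invℕ-* (k !) ((n ∸ k) !) {{k !≢0}} {{(n ∸ k) !≢0}} ⟩
    invFact k * invFact (n ∸ k)          ∎

  invSuc*choose-suc : ∀ {a j} → j ≤ a → invSuc a * choose (suc a) j ≈ choose a j * invSuc (a ∸ j)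
  invSuc*choose-suc {a} {j} j≤a = trans (*-comm _ _) (fraction-≈ (suc a C j) (suc a) (a C j) (suc (a ∸ j))
    (P.trans (P.cong ((suc a C j) *ℕ_) (P.sym (ℕ.+-∸-assoc 1 j≤a))) ([1+n]Ck*[1+n∸k]≡nCk*[1+n] j≤a)))

  choose*invSuc : ∀ {n p} → p ≤ n → choose n p * invSuc p ≈ choose (suc n) (suc p) * invSuc n
  choose*invSuc {n} {p} p≤n = fraction-≈ (n C p) (suc p) (suc n C suc p) (suc n) (nCk*[1+n]≡[1+n]C[1+k]*[1+k] p≤n)

  choose-0 : ∀ n → choose n 0 ≈ 1#
  choose-0 n = fromℕ-1

  choose-n : ∀ n → choose n n ≈ 1#
  choose-n n = trans (reflexive (P.cong fromℕ (nCn≡1 n))) fromℕ-1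

  sum0-pascal : ∀ a (y : ℕ → Carrier) →
    sum0 (suc a) (λ i → choose (suc a) i * y i)
      ≈ sum0 a (λ i → choose a i * y (suc i)) + sum0 a (λ i → choose a i * y i)
  sum0-pascal a y = begin
    sum0 (suc a) (λ i → choose (suc a) i * y i)                                   ≈⟨ sum0-sucˡ a _ ⟩
    choose (suc a) 0 * y 0 + sum0 a (λ i → choose (suc a) (suc i) * y (suc i))    ≈⟨ +-congˡ (sum0-cong a pascal) ⟩
    y0 + sum0 a (λ i → choose a i * y (suc i) + choose a (suc i) * y (suc i))     ≈⟨ +-congˡ (sum0-+ a _ _) ⟩
    y0 + (S + sum0 a (λ i → choose a (suc i) * y (suc i)))                        ≈⟨ solve 3 (λ x p q → x :+ (p :+ q) := p :+ (x :+ q)) refl _ _ _ ⟩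
    S + (y0 + sum0 a (λ i → choose a (suc i) * y (suc i)))                        ≈⟨ +-congˡ (sum0-sucˡ a _) ⟨
    S + sum0 (suc a) (λ i → choose a i * y i)                                     ≈⟨ +-congˡ (sum0-sucʳ a _) ⟩
    S + (sum0 a (λ i → choose a i * y i) + choose a (suc a) * y (suc a))          ≈⟨ +-congˡ (+-congˡ last≈0) ⟩
    S + (sum0 a (λ i → choose a i * y i) + 0#)                                    ≈⟨ +-congˡ (+-identityʳ _) ⟩
    S + sum0 a (λ i → choose a i * y i)                                           ∎
    where
    y0 = choose (suc a) 0 * y 0
    S = sum0 a (λ i → choose a i * y (suc i))
    pascal : ∀ i → choose (suc a) (suc i) * y (suc i) ≈ choose a i * y (suc i) + choose a (suc i) * y (suc i)
    pascal i = trans (*-congʳ (trans (reflexive (P.cong fromℕ (P.sym (nCk+nC[k+1]≡[n+1]C[k+1] a i)))) (fromℕ-+ (a C i) (a C suc i))))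
                     (distribʳ _ _ _)
    last≈0 : choose a (suc a) * y (suc a) ≈ 0#
    last≈0 = trans (*-congʳ (reflexive (P.cong fromℕ (k>n⇒nCk≡0 (ℕ.n<1+n a))))) (zeroˡ _)

  binomial-theorem : ∀ x n → pow (x + 1#) n ≈ sum0 n (λ j → choose n j * pow x j)
  binomial-theorem x zero    = sym (trans (+-identityʳ _) (trans (*-congʳ (choose-0 0)) (*-identityˡ _)))
  binomial-theorem x (suc n) = sym (begin
    sum0 (suc n) (λ j → choose (suc n) j * pow x j)                           ≈⟨ sum0-pascal n _ ⟩
    sum0 n (λ j → choose n j * (x * pow x j)) + S
      ≈⟨ +-congʳ (sum0-cong n (λ j → solve 3 (λ a b c → a :* (b :* c) := b :* (a :* c)) refl _ _ _)) ⟩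
    sum0 n (λ j → x * (choose n j * pow x j)) + S                             ≈⟨ +-congʳ (*-distribˡ-sum0 n x _) ⟨
    x * S + S                                                                 ≈⟨ trans (distribʳ _ _ _) (+-congˡ (*-identityˡ _)) ⟨
    (x + 1#) * S                                                              ≈⟨ *-congˡ (binomial-theorem x n) ⟨
    pow (x + 1#) (suc n)                                                      ∎)
    where S = sum0 n (λ j → choose n j * pow x j)

  sum0-choose*sgn : ∀ n → sum0 n (λ l → choose n l * sgn l) ≈ δℕ n 0
  sum0-choose*sgn zero    = trans (+-identityʳ _) (trans (*-congʳ (choose-0 0)) (*-identityˡ _))
  sum0-choose*sgn (suc n) = begin
    sum0 (suc n) (λ l → choose (suc n) l * sgn l)                         ≈⟨ sum0-pascal n _ ⟩
    sum0 n (λ l → choose n l * sgn (suc l)) + S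
      ≈⟨ +-congʳ (trans (sum0-cong n (λ l → trans (*-congˡ (sgn-suc l)) (sym (-‿distribʳ-* _ _)))) (sym (-‿sum0 n _))) ⟩
    - S + S                                                               ≈⟨ -‿inverseˡ S ⟩
    0#                                                                    ∎
    where S = sum0 n (λ l → choose n l * sgn l)

  sum0-triangle : ∀ n (f : ℕ → ℕ → Carrier) →
    sum0 n (λ p → sum0 p (λ k → f p k)) ≈ sum0 n (λ k → sum0 (n ∸ k) (λ l → f (k +ℕ l) k))
  sum0-triangle zero    f = refl
  sum0-triangle (suc n) f = begin
    sum0 (suc n) (λ p → sum0 p (f p))                                                      ≈⟨ sum0-sucʳ n _ ⟩
    sum0 n (λ p → sum0 p (f p)) + sum0 (suc n) (f (suc n))                                 ≈⟨ +-cong (sum0-triangle n f) (sum0-sucʳ n _) ⟩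
    sum0 n (λ k → sum0 (n ∸ k) (λ l → f (k +ℕ l) k)) + (sum0 n (f (suc n)) + f (suc n) (suc n)) ≈⟨ +-assoc _ _ _ ⟨
    sum0 n (λ k → sum0 (n ∸ k) (λ l → f (k +ℕ l) k)) + sum0 n (f (suc n)) + f (suc n) (suc n)   ≈⟨ +-congʳ (sum0-+ n _ _) ⟨
    sum0 n (λ k → sum0 (n ∸ k) (λ l → f (k +ℕ l) k) + f (suc n) k) + f (suc n) (suc n)        ≈⟨ +-cong (sum0-cong-≤ n column) diagonal ⟩
    sum0 n (λ k → sum0 (suc n ∸ k) (λ l → f (k +ℕ l) k)) + sum0 (n ∸ n) (λ l → f (suc n +ℕ l) (suc n)) ≈⟨ sum0-sucʳ n _ ⟨
    sum0 (suc n) (λ k → sum0 (suc n ∸ k) (λ l → f (k +ℕ l) k))                             ∎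
    where
    diagonal : f (suc n) (suc n) ≈ sum0 (n ∸ n) (λ l → f (suc n +ℕ l) (suc n))
    diagonal = begin
      f (suc n) (suc n)                              ≡⟨ P.cong (λ z → f z (suc n)) (P.sym (ℕ.+-identityʳ (suc n))) ⟩
      f (suc n +ℕ 0) (suc n)                         ≈⟨ +-identityʳ _ ⟨
      sum0 0 (λ l → f (suc n +ℕ l) (suc n))          ≡⟨ P.cong (λ z → sum0 z (λ l → f (suc n +ℕ l) (suc n))) (P.sym (ℕ.n∸n≡0 n)) ⟩
      sum0 (n ∸ n) (λ l → f (suc n +ℕ l) (suc n))    ∎
    column : ∀ k → k ≤ n → sum0 (n ∸ k) (λ l → f (k +ℕ l) k) + f (suc n) k ≈ sum0 (suc n ∸ k) (λ l → f (k +ℕ l) k)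
    column k k≤n = begin
      sum0 (n ∸ k) (λ l → f (k +ℕ l) k) + f (suc n) k
        ≡⟨ P.cong (λ z → sum0 (n ∸ k) (λ l → f (k +ℕ l) k) + f z k) (P.sym (P.trans (ℕ.+-suc k (n ∸ k)) (P.cong suc (ℕ.m+[n∸m]≡n k≤n)))) ⟩
      sum0 (n ∸ k) (λ l → f (k +ℕ l) k) + f (k +ℕ suc (n ∸ k)) k   ≈⟨ sum0-sucʳ (n ∸ k) _ ⟨
      sum0 (suc (n ∸ k)) (λ l → f (k +ℕ l) k)                       ≡⟨ P.cong (λ z → sum0 z (λ l → f (k +ℕ l) k)) (P.sym (ℕ.+-∸-assoc 1 k≤n)) ⟩
      sum0 (suc n ∸ k) (λ l → f (k +ℕ l) k)                         ∎

  sum0-choose*sgn*invSuc : ∀ n → sum0 n (λ p → (choose n p * sgn p) * invSuc p) ≈ invSuc n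
  sum0-choose*sgn*invSuc n = begin
    sum0 n (λ p → (choose n p * sgn p) * invSuc p)                   ≈⟨ sum0-cong-≤ n shift ⟩
    sum0 n (λ p → (choose (suc n) (suc p) * sgn p) * invSuc n)       ≈⟨ *-distribʳ-sum0 n _ _ ⟨
    S * invSuc n                                                     ≈⟨ *-congʳ S≈1 ⟩
    1# * invSuc n                                                    ≈⟨ *-identityˡ _ ⟩
    invSuc n                                                         ∎
    where
    shift : ∀ p → p ≤ n → (choose n p * sgn p) * invSuc p ≈ (choose (suc n) (suc p) * sgn p) * invSuc n
    shift p p≤n = begin
      (choose n p * sgn p) * invSuc p                  ≈⟨ solve 3 (λ a s j → (a :* s) :* j := (a :* j) :* s) refl _ _ _ ⟩
      (choose n p * invSuc p) * sgn p                  ≈⟨ *-congʳ (choose*invSuc p≤n) ⟩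
      (choose (suc n) (suc p) * invSuc n) * sgn p      ≈⟨ solve 3 (λ a j s → (a :* j) :* s := (a :* s) :* j) refl _ _ _ ⟩
      (choose (suc n) (suc p) * sgn p) * invSuc n      ∎
    S = sum0 n (λ p → choose (suc n) (suc p) * sgn p)
    1-S≈0 : 1# - S ≈ 0#
    1-S≈0 = begin
      1# - S                                                     ≈⟨ +-cong (sym (trans (*-congʳ (choose-0 (suc n))) (*-identityˡ _)))
                                                                            (trans (-‿sum0 n _) (sum0-cong n (λ p → trans (-‿distribʳ-* _ _) (*-congˡ (sym (sgn-suc p)))))) ⟩
      choose (suc n) 0 * 1# + sum0 n (λ p → choose (suc n) (suc p) * sgn (suc p)) ≈⟨ sum0-sucˡ n _ ⟨
      sum0 (suc n) (λ l → choose (suc n) l * sgn l)              ≈⟨ sum0-choose*sgn (suc n) ⟩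
      0#                                                         ∎
    S≈1 : S ≈ 1#
    S≈1 = begin
      S               ≈⟨ solve 2 (λ s o → s := o :- (o :- s)) refl S 1# ⟩
      1# - (1# - S)   ≈⟨ +-congˡ (-‿cong 1-S≈0) ⟩
      1# - 0#         ≈⟨ trans (+-congˡ -0#≈0#) (+-identityʳ 1#) ⟩
      1#              ∎

  choose*choose : ∀ {n k l} → k ≤ n → l ≤ n ∸ k → choose n (k +ℕ l) * choose (k +ℕ l) k ≈ choose n k * choose (n ∸ k) l
  choose*choose {n} {k} {l} k≤n l≤n∸k = begin
    choose n (k +ℕ l) * choose (k +ℕ l) k               ≈⟨ fromℕ-* (n C (k +ℕ l)) ((k +ℕ l) C k) ⟨
    fromℕ ((n C (k +ℕ l)) *ℕ ((k +ℕ l) C k))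
      ≡⟨ P.cong fromℕ (nCm*mCk≡nCk*[n∸k]C[m∸k] (ℕ.m≤m+n k l) (P.subst (_≤ n) (ℕ.+-comm l k) (ℕ.m≤o∸n⇒m+n≤o l k≤n l≤n∸k))) ⟩
    fromℕ ((n C k) *ℕ ((n ∸ k) C ((k +ℕ l) ∸ k)))       ≡⟨ P.cong (λ z → fromℕ ((n C k) *ℕ ((n ∸ k) C z))) (ℕ.m+n∸m≡n k l) ⟩
    fromℕ ((n C k) *ℕ ((n ∸ k) C l))                    ≈⟨ fromℕ-* (n C k) ((n ∸ k) C l) ⟩
    choose n k * choose (n ∸ k) l                       ∎

  binomial-inversion : ∀ n (w : ℕ → Carrier) →
    sum0 n (λ p → (choose n p * sgn p) * sum0 p (λ k → choose p k * w k)) ≈ sgn n * w n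
  binomial-inversion n w = begin
    sum0 n (λ p → (choose n p * sgn p) * sum0 p (λ k → choose p k * w k))
      ≈⟨ sum0-cong n (λ p → *-distribˡ-sum0 p _ _) ⟩
    sum0 n (λ p → sum0 p (λ k → (choose n p * sgn p) * (choose p k * w k)))        ≈⟨ sum0-triangle n _ ⟩
    sum0 n (λ k → sum0 (n ∸ k) (λ l → (choose n (k +ℕ l) * sgn (k +ℕ l)) * (choose (k +ℕ l) k * w k)))
      ≈⟨ sum0-cong-≤ n (λ k k≤n → trans (sum0-cong-≤ (n ∸ k) (λ l l≤ → regroup k≤n l≤)) (sym (*-distribˡ-sum0 (n ∸ k) _ _))) ⟩
    sum0 n (λ k → (choose n k * (sgn k * w k)) * sum0 (n ∸ k) (λ l → choose (n ∸ k) l * sgn l))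
      ≈⟨ sum0-cong n (λ k → trans (*-congˡ (sum0-choose*sgn (n ∸ k))) (*-comm _ _)) ⟩
    sum0 n (λ k → δℕ (n ∸ k) 0 * (choose n k * (sgn k * w k)))                     ≈⟨ sum0-δℕ-∸ n _ ⟩
    choose n n * (sgn n * w n)                                                      ≈⟨ trans (*-congʳ (choose-n n)) (*-identityˡ _) ⟩
    sgn n * w n                                                                     ∎
    where
    regroup : ∀ {k l} → k ≤ n → l ≤ n ∸ k →
      (choose n (k +ℕ l) * sgn (k +ℕ l)) * (choose (k +ℕ l) k * w k)
        ≈ (choose n k * (sgn k * w k)) * (choose (n ∸ k) l * sgn l)
    regroup {k} {l} k≤n l≤n∸k = begin
      (choose n (k +ℕ l) * sgn (k +ℕ l)) * (choose (k +ℕ l) k * w k)       ≈⟨ *-congʳ (*-congˡ (sgn-+ k l)) ⟩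
      (choose n (k +ℕ l) * (sgn k * sgn l)) * (choose (k +ℕ l) k * w k)
        ≈⟨ solve 5 (λ A s t B w → (A :* (s :* t)) :* (B :* w) := (A :* B) :* ((s :* w) :* t)) refl _ _ _ _ _ ⟩
      (choose n (k +ℕ l) * choose (k +ℕ l) k) * ((sgn k * w k) * sgn l)    ≈⟨ *-congʳ (choose*choose {n} {k} {l} k≤n l≤n∸k) ⟩
      (choose n k * choose (n ∸ k) l) * ((sgn k * w k) * sgn l)
        ≈⟨ solve 4 (λ A B w t → (A :* B) :* (w :* t) := (A :* w) :* (B :* t)) refl _ _ _ _ ⟩
      (choose n k * (sgn k * w k)) * (choose (n ∸ k) l * sgn l)            ∎

  -- The coefficients ω

  -- n! times the coefficient of xⁿ in (ζ eˣ − 1)(d/x + Σₖ ωₖ xᵏ/k!) = 1, where d ζ = d.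
  OmegaRecurrence : Carrier → Carrier → (ℕ → Carrier) → Set ℓ
  OmegaRecurrence ζ d ω = ∀ n → ζ * sum0 n (λ k → choose n k * ω k) ≈ ω n + δℕ n 0 - d * invSuc n

  omegaRecurrence : ∀ {ζ d} (ω : ℕ → Carrier) → d * ζ ≈ d →
    (∀ n → d * (ζ * invFact (suc n) - δℕ (suc n) 0)
           + sum0 n (λ k → (ζ * invFact (n ∸ k) - δℕ (n ∸ k) 0) * (ω k * invFact k)) ≈ δℕ n 0) →
    OmegaRecurrence ζ d ω
  omegaRecurrence {ζ} {d} ω dζ≈d coeff n = begin
    ζ * S                                                  ≈⟨ solve 3 (λ p s w → s := p :+ (s :- w) :+ w :- p) refl (d * invSuc n) (ζ * S) (ω n) ⟩
    d * invSuc n + (ζ * S - ω n) + ω n - d * invSuc n      ≈⟨ +-congʳ (+-congʳ scaled) ⟩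
    δℕ n 0 + ω n - d * invSuc n                            ≈⟨ +-congʳ (+-comm _ _) ⟩
    ω n + δℕ n 0 - d * invSuc n                            ∎
    where
    S = sum0 n (λ k → choose n k * ω k)
    n! = fromℕ (n !)
    polePart : n! * (d * (ζ * invFact (suc n) - δℕ (suc n) 0)) ≈ d * invSuc n
    polePart = begin
      n! * (d * (ζ * invFact (suc n) - 0#))             ≈⟨ *-congˡ (*-congˡ (trans (+-congˡ -0#≈0#) (+-identityʳ _))) ⟩
      n! * (d * (ζ * invFact (suc n)))                  ≈⟨ solve 4 (λ f d z i → f :* (d :* (z :* i)) := (d :* z) :* (f :* i)) refl _ _ _ _ ⟩
      (d * ζ) * (n! * invFact (suc n))                  ≈⟨ *-cong dζ≈d (fromℕ-fact*invFact-suc n) ⟩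
      d * invSuc n                                      ∎
    n!*invFact*invFact : ∀ k → k ≤ n → n! * (invFact k * invFact (n ∸ k)) ≈ choose n k
    n!*invFact*invFact k k≤n = begin
      n! * (invFact k * invFact (n ∸ k))   ≈⟨ *-congˡ (choose*invFact k≤n) ⟨
      n! * (choose n k * invFact n)        ≈⟨ solve 3 (λ f c i → f :* (c :* i) := c :* (f :* i)) refl _ _ _ ⟩
      choose n k * (n! * invFact n)        ≈⟨ *-congˡ (fromℕ-fact*invFact n) ⟩
      choose n k * 1#                      ≈⟨ *-identityʳ _ ⟩
      choose n k                           ∎
    regularPart : n! * sum0 n (λ k → (ζ * invFact (n ∸ k) - δℕ (n ∸ k) 0) * (ω k * invFact k)) ≈ ζ * S - ω n
    regularPart = begin
      n! * sum0 n (λ k → (ζ * invFact (n ∸ k) - δℕ (n ∸ k) 0) * (ω k * invFact k))   ≈⟨ *-distribˡ-sum0 n _ _ ⟩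
      sum0 n (λ k → n! * ((ζ * invFact (n ∸ k) - δℕ (n ∸ k) 0) * (ω k * invFact k)))
        ≈⟨ sum0-cong n (λ k → solve 6 (λ f z a e w b → f :* ((z :* a :- e) :* (w :* b)) := z :* ((f :* (b :* a)) :* w) :- e :* (f :* (w :* b))) refl _ _ _ _ _ _) ⟩
      sum0 n (λ k → ζ * ((n! * (invFact k * invFact (n ∸ k))) * ω k) - δℕ (n ∸ k) 0 * (n! * (ω k * invFact k)))  ≈⟨ sum0-- n _ _ ⟩
      sum0 n (λ k → ζ * ((n! * (invFact k * invFact (n ∸ k))) * ω k)) - sum0 n (λ k → δℕ (n ∸ k) 0 * (n! * (ω k * invFact k)))
        ≈⟨ +-cong (trans (sum0-cong-≤ n (λ k k≤n → *-congˡ (*-congʳ (n!*invFact*invFact k k≤n)))) (sym (*-distribˡ-sum0 n ζ _)))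
                  (-‿cong (sum0-δℕ-∸ n _)) ⟩
      ζ * S - n! * (ω n * invFact n)
        ≈⟨ +-congˡ (-‿cong (trans (solve 3 (λ f w i → f :* (w :* i) := w :* (f :* i)) refl _ _ _) (trans (*-congˡ (fromℕ-fact*invFact n)) (*-identityʳ _)))) ⟩
      ζ * S - ω n                                      ∎
    n!*δℕ : ∀ n → fromℕ (n !) * δℕ n 0 ≈ δℕ n 0
    n!*δℕ zero    = trans (*-congʳ fromℕ-1) (*-identityˡ _)
    n!*δℕ (suc n) = zeroʳ _
    scaled : d * invSuc n + (ζ * S - ω n) ≈ δℕ n 0
    scaled = begin
      d * invSuc n + (ζ * S - ω n)    ≈⟨ +-cong polePart regularPart ⟨
      n! * (d * (ζ * invFact (suc n) - δℕ (suc n) 0)) + n! * sum0 n (λ k → (ζ * invFact (n ∸ k) - δℕ (n ∸ k) 0) * (ω k * invFact k))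
                                      ≈⟨ distribˡ _ _ _ ⟨
      n! * (d * (ζ * invFact (suc n) - δℕ (suc n) 0) + sum0 n (λ k → (ζ * invFact (n ∸ k) - δℕ (n ∸ k) 0) * (ω k * invFact k)))
                                      ≈⟨ *-congˡ (coeff n) ⟩
      n! * δℕ n 0                     ≈⟨ n!*δℕ n ⟩
      δℕ n 0                          ∎

  -- The n-th equation fixes ωₙ through the factor ζ − 1 when ζ ≠ 1; when ζ = 1 the (n+1)-th
  -- equation fixes it through the factor n + 1.
  omegaRecurrence-unique : ∀ {ζ d x y} → (¬ ζ ≈ 1#) ⊎ (ζ ≈ 1#) →
    OmegaRecurrence ζ d x → OmegaRecurrence ζ d y → ∀ n → x n ≈ y n
  omegaRecurrence-unique {ζ} {d} {x} {y} ζ≉1⊎ζ≈1 recX recY n = begin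
    x n            ≈⟨ solve 2 (λ a b → a := (a :- b) :+ b) refl (x n) (y n) ⟩
    z n + y n      ≈⟨ +-congʳ (<-rec (λ n → z n ≈ 0#) (step ζ≉1⊎ζ≈1) n) ⟩
    0# + y n       ≈⟨ +-identityˡ _ ⟩
    y n            ∎
    where
    z : ℕ → Carrier
    z k = x k - y k
    S : ℕ → Carrier
    S n = sum0 n (λ k → choose n k * z k)
    recZ : ∀ n → ζ * S n ≈ z n
    recZ n = begin
      ζ * S n
        ≈⟨ *-congˡ (trans (sum0-cong n (λ k → solve 3 (λ c a b → c :* (a :- b) := c :* a :- c :* b) refl _ _ _)) (sum0-- n _ _)) ⟩
      ζ * (sum0 n (λ k → choose n k * x k) - sum0 n (λ k → choose n k * y k))
                                                                ≈⟨ solve 3 (λ w a b → w :* (a :- b) := w :* a :- w :* b) refl _ _ _ ⟩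
      ζ * sum0 n (λ k → choose n k * x k) - ζ * sum0 n (λ k → choose n k * y k) ≈⟨ +-cong (recX n) (-‿cong (recY n)) ⟩
      (x n + δℕ n 0 - d * invSuc n) - (y n + δℕ n 0 - d * invSuc n) ≈⟨ solve 4 (λ a b e t → (a :+ e :- t) :- (b :+ e :- t) := a :- b) refl _ _ _ _ ⟩
      z n                                                       ∎
    only-top-term : ∀ n → (∀ {k} → k < n → z k ≈ 0#) → ∀ m → sum0 n (λ k → choose m k * z k) ≈ choose m n * z n
    only-top-term n below m = sum0-single n n ℕ.≤-refl (λ k k≤n k≢n → trans (*-congˡ (below (ℕ.≤∧≢⇒< k≤n k≢n))) (zeroʳ _))
    step : (¬ ζ ≈ 1#) ⊎ (ζ ≈ 1#) → ∀ n → (∀ {k} → k < n → z k ≈ 0#) → z n ≈ 0#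
    step (inj₁ ζ≉1) n below = *-cancelˡ-≉0 (z n) ζ-1≉0 (begin
      (ζ - 1#) * z n                ≈⟨ solve 3 (λ w o t → (w :- o) :* t := w :* t :- o :* t) refl ζ 1# (z n) ⟩
      ζ * z n - 1# * z n            ≈⟨ +-cong (*-congˡ (sym S≈z)) (-‿cong (*-identityˡ _)) ⟩
      ζ * S n - z n                 ≈⟨ +-congʳ (recZ n) ⟩
      z n - z n                     ≈⟨ -‿inverseʳ _ ⟩
      0#                            ∎)
      where
      S≈z : S n ≈ z n
      S≈z = trans (only-top-term n below n) (trans (*-congʳ (choose-n n)) (*-identityˡ _))
      ζ-1≉0 : ¬ ζ - 1# ≈ 0#
      ζ-1≉0 ζ-1≈0 = ζ≉1 (begin
        ζ               ≈⟨ solve 2 (λ w o → w := (w :- o) :+ o) refl ζ 1# ⟩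
        (ζ - 1#) + 1#   ≈⟨ +-congʳ ζ-1≈0 ⟩
        0# + 1#         ≈⟨ +-identityˡ _ ⟩
        1#              ∎)
    step (inj₂ ζ≈1) n below = fromℕ-cancelˡ (suc n) (z n) 0# (trans (begin
      fromℕ (suc n) * z n                                   ≈⟨ solve 2 (λ a b → a := (a :+ b) :- b) refl _ (z (suc n)) ⟩
      (fromℕ (suc n) * z n + z (suc n)) - z (suc n)
        ≈⟨ +-congʳ (+-cong (sym lower) (sym (trans (*-congʳ (choose-n (suc n))) (*-identityˡ _)))) ⟩
      (sum0 n (λ k → choose (suc n) k * z k) + choose (suc n) (suc n) * z (suc n)) - z (suc n)
                                                            ≈⟨ +-congʳ (sym (sum0-sucʳ n _)) ⟩
      S (suc n) - z (suc n)                                 ≈⟨ +-congʳ (sym (trans (*-congʳ ζ≈1) (*-identityˡ _))) ⟩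
      ζ * S (suc n) - z (suc n)                             ≈⟨ +-congʳ (recZ (suc n)) ⟩
      z (suc n) - z (suc n)                                 ≈⟨ -‿inverseʳ _ ⟩
      0#                                                    ∎) (sym (zeroʳ _)))
      where
      lower : sum0 n (λ k → choose (suc n) k * z k) ≈ fromℕ (suc n) * z n
      lower = trans (only-top-term n below (suc n)) (*-congʳ (reflexive (P.cong fromℕ ([1+n]Cn≡1+n n))))

  -- The recurrence for ζ⁻¹ is solved by the reflection, as 1/(ζ⁻¹eˣ − 1) = −1 − 1/(ζe⁻ˣ − 1).
  omega-reflection : ∀ {ζ ζ' d ω ω'} → ζ * ζ' ≈ 1# → d * ζ' ≈ d → (¬ ζ' ≈ 1#) ⊎ (ζ' ≈ 1#) →
    OmegaRecurrence ζ d ω → OmegaRecurrence ζ' d ω' → ∀ n → ω' n ≈ - (sgn n * ω n) - δℕ n 0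
  omega-reflection {ζ} {ζ'} {d} {ω} {ω'} ζζ'≈1 dζ'≈d ζ'≉1⊎ζ'≈1 rec rec' =
    omegaRecurrence-unique ζ'≉1⊎ζ'≈1 rec' reflected
    where
    U : ℕ → Carrier
    U n = sum0 n (λ p → choose n p * (sgn p * ω p))
    inverted : ∀ n → ζ * (sgn n * ω n) ≈ U n + 1# - d * invSuc n
    inverted n = begin
      ζ * (sgn n * ω n)                                                        ≈⟨ *-congˡ (binomial-inversion n ω) ⟨
      ζ * sum0 n (λ p → (choose n p * sgn p) * sum0 p (λ k → choose p k * ω k)) ≈⟨ *-distribˡ-sum0 n ζ _ ⟩
      sum0 n (λ p → ζ * ((choose n p * sgn p) * sum0 p (λ k → choose p k * ω k)))
        ≈⟨ sum0-cong n (λ p → trans (solve 3 (λ z a s → z :* (a :* s) := a :* (z :* s)) refl _ _ _) (*-congˡ (rec p))) ⟩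
      sum0 n (λ p → (choose n p * sgn p) * (ω p + δℕ p 0 - d * invSuc p))
        ≈⟨ sum0-cong n (λ p → solve 6 (λ c s w e dd j → (c :* s) :* (w :+ e :- dd :* j) := (c :* (s :* w) :+ e :* (c :* s)) :- dd :* ((c :* s) :* j)) refl _ _ _ _ _ _) ⟩
      sum0 n (λ p → (choose n p * (sgn p * ω p) + δℕ p 0 * (choose n p * sgn p)) - d * ((choose n p * sgn p) * invSuc p))
        ≈⟨ trans (sum0-- n _ _) (+-cong (sum0-+ n _ _) (-‿cong (sym (*-distribˡ-sum0 n d _)))) ⟩
      U n + sum0 n (λ p → δℕ p 0 * (choose n p * sgn p)) - d * sum0 n (λ p → (choose n p * sgn p) * invSuc p)
        ≈⟨ +-cong (+-congˡ (trans (sum0-δℕ-0 n _) (trans (*-congʳ (choose-0 n)) (*-identityˡ _)))) (-‿cong (*-congˡ (sum0-choose*sgn*invSuc n))) ⟩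
      U n + 1# - d * invSuc n                                                  ∎
    reflected : OmegaRecurrence ζ' d (λ n → - (sgn n * ω n) - δℕ n 0)
    reflected n = begin
      ζ' * sum0 n (λ k → choose n k * (- (sgn k * ω k) - δℕ k 0))
        ≈⟨ *-congˡ (sum0-cong n (λ k → solve 4 (λ c s w e → c :* (:- (s :* w) :- e) := :- (c :* (s :* w)) :- e :* c) refl _ _ _ _)) ⟩
      ζ' * sum0 n (λ k → - (choose n k * (sgn k * ω k)) - δℕ k 0 * choose n k)
        ≈⟨ *-congˡ (trans (sum0-- n _ _) (+-cong (sym (-‿sum0 n _)) (-‿cong (trans (sum0-δℕ-0 n _) (choose-0 n))))) ⟩
      ζ' * (- U n - 1#)
        ≈⟨ solve 5 (λ z u o dd j → z :* (:- u :- o) := :- (z :* (u :+ o :- dd :* j)) :- (dd :* z) :* j) refl ζ' (U n) 1# d (invSuc n) ⟩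
      - (ζ' * (U n + 1# - d * invSuc n)) - (d * ζ') * invSuc n
        ≈⟨ +-cong (-‿cong (*-congˡ (sym (inverted n)))) (-‿cong (*-congʳ dζ'≈d)) ⟩
      - (ζ' * (ζ * (sgn n * ω n))) - d * invSuc n
        ≈⟨ +-congʳ (-‿cong (trans (sym (*-assoc _ _ _)) (trans (*-congʳ (trans (*-comm _ _) ζζ'≈1)) (*-identityˡ _)))) ⟩
      - (sgn n * ω n) - d * invSuc n
        ≈⟨ solve 3 (λ y e t → y :- t := y :- e :+ e :- t) refl (- (sgn n * ω n)) (δℕ n 0) (d * invSuc n) ⟩
      (- (sgn n * ω n) - δℕ n 0) + δℕ n 0 - d * invSuc n                        ∎

  omegaRecurrence-congᵈ : ∀ {ζ d d' ω} → d ≈ d' → OmegaRecurrence ζ d ω → OmegaRecurrence ζ d' ω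
  omegaRecurrence-congᵈ d≈d' rec n = trans (rec n) (+-congˡ (-‿cong (*-congʳ d≈d')))

  -- Twisted power sums

  ShiftRecurrence : Carrier → (ℕ → ℕ → Carrier) → Set ℓ
  ShiftRecurrence x f = ∀ a b → f a (suc b) ≈ x * f a b - f (suc a) b

  shiftRecurrence-+ : ∀ {x f g} → ShiftRecurrence x f → ShiftRecurrence x g → ShiftRecurrence x (λ a b → f a b + g a b)
  shiftRecurrence-+ {x} {f} {g} recF recG a b = trans (+-cong (recF a b) (recG a b))
    (solve 5 (λ x p q r s → (x :* p :- q) :+ (x :* r :- s) := x :* (p :+ r) :- (q :+ s)) refl x _ _ _ _)

  shiftRecurrence-unique : ∀ {x f g} → ShiftRecurrence x f → ShiftRecurrence x g →
    (∀ a → f a 0 ≈ g a 0) → ∀ b a → f a b ≈ g a b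
  shiftRecurrence-unique recF recG base zero    a = base a
  shiftRecurrence-unique recF recG base (suc b) a = trans (recF a b) (trans
    (+-cong (*-congˡ (shiftRecurrence-unique recF recG base b a)) (-‿cong (shiftRecurrence-unique recF recG base b (suc a))))
    (sym (recG a b)))

  module PowerSums {ζ d : Carrier} {ω : ℕ → Carrier} (dζ≈d : d * ζ ≈ d) (rec : OmegaRecurrence ζ d ω) where

    appell : ℕ → Carrier → Carrier
    appell a x = sum0 a (λ i → choose a i * (ω (a ∸ i) * pow x i))

    powerDifference : ℕ → Carrier → Carrier
    powerDifference a x = sum0 a (λ j → choose a j * (invSuc (a ∸ j) * pow x j))

    appell-cong : ∀ a {x y} → x ≈ y → appell a x ≈ appell a y
    appell-cong a x≈y = sum0-cong a (λ i → *-congˡ (*-congˡ (pow-cong i x≈y)))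

    appell-0 : ∀ a → appell a 0# ≈ ω a
    appell-0 a = trans (sum0-single a 0 z≤n higher≈0) (trans (*-cong (choose-0 a) (*-identityʳ _)) (*-identityˡ _))
      where
      higher≈0 : ∀ i → i ≤ a → ¬ i ≡ 0 → choose a i * (ω (a ∸ i) * pow 0# i) ≈ 0#
      higher≈0 zero    _ 0≢0 = ⊥-elim (0≢0 P.refl)
      higher≈0 (suc i) _ _   = trans (*-congˡ (trans (*-congˡ (zeroˡ _)) (zeroʳ _))) (zeroʳ _)

    rec-reversed : ∀ p → ζ * sum0 p (λ l → choose p l * ω (p ∸ l)) ≈ ω p + δℕ p 0 - d * invSuc p
    rec-reversed p = trans (*-congˡ (trans (sum0-reverse p _) (sum0-cong-≤ p symmetry))) (rec p)
      where
      symmetry : ∀ l → l ≤ p → choose p (p ∸ l) * ω (p ∸ (p ∸ l)) ≈ choose p l * ω l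
      symmetry l l≤p = *-cong (reflexive (P.cong fromℕ (P.sym (nCk≡nC[n∸k] l≤p)))) (reflexive (P.cong ω (ℕ.m∸[m∸n]≡n l≤p)))

    appell-shift : ∀ a x → ζ * appell a (x + 1#) ≈ appell a x + pow x a - d * powerDifference a x
    appell-shift a x = begin
      ζ * appell a (x + 1#)                                          ≈⟨ *-congˡ (trans expand (trans (sum0-triangle a _) regroup)) ⟩
      ζ * sum0 a (λ j → (choose a j * pow x j) * V (a ∸ j))          ≈⟨ *-distribˡ-sum0 a ζ _ ⟩
      sum0 a (λ j → ζ * ((choose a j * pow x j) * V (a ∸ j)))        ≈⟨ sum0-cong a useRec ⟩
      sum0 a (λ j → (choose a j * (ω (a ∸ j) * pow x j) + δℕ (a ∸ j) 0 * (choose a j * pow x j)) - d * (choose a j * (invSuc (a ∸ j) * pow x j)))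
                                                                     ≈⟨ trans (sum0-- a _ _) (+-cong (sum0-+ a _ _) (-‿cong (sym (*-distribˡ-sum0 a d _)))) ⟩
      appell a x + sum0 a (λ j → δℕ (a ∸ j) 0 * (choose a j * pow x j)) - d * powerDifference a x
                                                                     ≈⟨ +-congʳ (+-congˡ (trans (sum0-δℕ-∸ a _) (trans (*-congʳ (choose-n a)) (*-identityˡ _)))) ⟩
      appell a x + pow x a - d * powerDifference a x                 ∎
      where
      V : ℕ → Carrier
      V p = sum0 p (λ l → choose p l * ω (p ∸ l))
      expand : appell a (x + 1#) ≈ sum0 a (λ i → sum0 i (λ j → choose a i * (ω (a ∸ i) * (choose i j * pow x j))))
      expand = sum0-cong a (λ i → trans (*-congˡ (trans (*-congˡ (binomial-theorem x i)) (*-distribˡ-sum0 i _ _))) (*-distribˡ-sum0 i _ _))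
      regroup : sum0 a (λ j → sum0 (a ∸ j) (λ l → choose a (j +ℕ l) * (ω (a ∸ (j +ℕ l)) * (choose (j +ℕ l) j * pow x j))))
                ≈ sum0 a (λ j → (choose a j * pow x j) * V (a ∸ j))
      regroup = sum0-cong-≤ a (λ j j≤a → trans (sum0-cong-≤ (a ∸ j) (λ l l≤ → term j≤a l≤)) (sym (*-distribˡ-sum0 (a ∸ j) _ _)))
        where
        term : ∀ {j l} → j ≤ a → l ≤ a ∸ j →
          choose a (j +ℕ l) * (ω (a ∸ (j +ℕ l)) * (choose (j +ℕ l) j * pow x j)) ≈ (choose a j * pow x j) * (choose (a ∸ j) l * ω (a ∸ j ∸ l))
        term {j} {l} j≤a l≤a∸j = begin
          choose a (j +ℕ l) * (ω (a ∸ (j +ℕ l)) * (choose (j +ℕ l) j * pow x j))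
            ≈⟨ solve 4 (λ A w B X → A :* (w :* (B :* X)) := (A :* B) :* (X :* w)) refl _ _ _ _ ⟩
          (choose a (j +ℕ l) * choose (j +ℕ l) j) * (pow x j * ω (a ∸ (j +ℕ l)))
            ≈⟨ *-cong (choose*choose {a} {j} {l} j≤a l≤a∸j) (*-congˡ (reflexive (P.cong ω (P.sym (ℕ.∸-+-assoc a j l))))) ⟩
          (choose a j * choose (a ∸ j) l) * (pow x j * ω (a ∸ j ∸ l))
            ≈⟨ solve 4 (λ A B X w → (A :* B) :* (X :* w) := (A :* X) :* (B :* w)) refl _ _ _ _ ⟩
          (choose a j * pow x j) * (choose (a ∸ j) l * ω (a ∸ j ∸ l)) ∎
      useRec : ∀ j → ζ * ((choose a j * pow x j) * V (a ∸ j))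
                     ≈ (choose a j * (ω (a ∸ j) * pow x j) + δℕ (a ∸ j) 0 * (choose a j * pow x j)) - d * (choose a j * (invSuc (a ∸ j) * pow x j))
      useRec j = begin
        ζ * ((choose a j * pow x j) * V (a ∸ j))                ≈⟨ solve 4 (λ z A X v → z :* ((A :* X) :* v) := (A :* X) :* (z :* v)) refl _ _ _ _ ⟩
        (choose a j * pow x j) * (ζ * V (a ∸ j))                ≈⟨ *-congˡ (rec-reversed (a ∸ j)) ⟩
        (choose a j * pow x j) * (ω (a ∸ j) + δℕ (a ∸ j) 0 - d * invSuc (a ∸ j))
          ≈⟨ solve 6 (λ A X w e dd jj → (A :* X) :* (w :+ e :- dd :* jj) := (A :* (w :* X) :+ e :* (A :* X)) :- dd :* (A :* (jj :* X))) refl _ _ _ _ _ _ ⟩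
        (choose a j * (ω (a ∸ j) * pow x j) + δℕ (a ∸ j) 0 * (choose a j * pow x j)) - d * (choose a j * (invSuc (a ∸ j) * pow x j)) ∎

    invSuc*pow-suc : ∀ a x → invSuc a * pow (x + 1#) (suc a) ≈ powerDifference a x + invSuc a * pow x (suc a)
    invSuc*pow-suc a x = begin
      invSuc a * pow (x + 1#) (suc a)                       ≈⟨ *-congˡ (trans (binomial-theorem x (suc a)) (sum0-sucʳ a _)) ⟩
      invSuc a * (sum0 a (λ j → choose (suc a) j * pow x j) + choose (suc a) (suc a) * pow x (suc a))
                                                            ≈⟨ distribˡ _ _ _ ⟩
      invSuc a * sum0 a (λ j → choose (suc a) j * pow x j) + invSuc a * (choose (suc a) (suc a) * pow x (suc a))
        ≈⟨ +-cong (trans (*-distribˡ-sum0 a _ _) (sum0-cong-≤ a (λ j j≤a → trans (sym (*-assoc _ _ _)) (trans (*-congʳ (invSuc*choose-suc j≤a)) (*-assoc _ _ _)))))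
                  (*-congˡ (trans (*-congʳ (choose-n (suc a))) (*-identityˡ _))) ⟩
      powerDifference a x + invSuc a * pow x (suc a)        ∎

    powerSum : ∀ a m → sum< m (λ v → pow ζ v * pow (fromℕ v) a)
                       ≈ d * (invSuc a * (pow ζ m * pow (fromℕ m) (suc a))) + pow ζ m * appell a (fromℕ m) - ω a
    powerSum a zero = sym (begin
      d * (invSuc a * (1# * (0# * pow 0# a))) + 1# * appell a 0# - ω a   ≈⟨ +-congʳ (+-cong vanish (trans (*-identityˡ _) (appell-0 a))) ⟩
      0# + ω a - ω a                                                     ≈⟨ trans (+-congʳ (+-identityˡ _)) (-‿inverseʳ _) ⟩
      0#                                                                 ∎)
      where
      vanish : d * (invSuc a * (1# * (0# * pow 0# a))) ≈ 0#
      vanish = trans (*-congˡ (trans (*-congˡ (trans (*-congˡ (zeroˡ _)) (zeroʳ _))) (zeroʳ _))) (zeroʳ _)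
    powerSum a (suc m) = begin
      sum< m (λ v → pow ζ v * pow (fromℕ v) a) + pow ζ m * pow x a             ≈⟨ +-congʳ (powerSum a m) ⟩
      d * (invSuc a * (z * X)) + z * appell a x - ω a + z * pow x a
        ≈⟨ solve 8 (λ d j z X q w xa S → d :* (j :* (z :* X)) :+ z :* q :- w :+ z :* xa
                                      := d :* (z :* (S :+ j :* X)) :+ z :* (q :+ xa :- d :* S) :- w)
                   refl d (invSuc a) z X (appell a x) (ω a) (pow x a) (powerDifference a x) ⟩
      d * (z * (powerDifference a x + invSuc a * X)) + z * (appell a x + pow x a - d * powerDifference a x) - ω a
                                                                                ≈⟨ +-congʳ (+-cong (sym polePart) (sym appellPart)) ⟩
      d * (invSuc a * (pow ζ (suc m) * pow x+1 (suc a))) + pow ζ (suc m) * appell a x+1 - ω a ∎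
      where
      x = fromℕ m
      x+1 = fromℕ (suc m)
      z = pow ζ m
      X = pow x (suc a)
      x+1≈x+1# : x+1 ≈ x + 1#
      x+1≈x+1# = +-comm _ _
      appellPart : pow ζ (suc m) * appell a x+1 ≈ z * (appell a x + pow x a - d * powerDifference a x)
      appellPart = trans (*-cong (*-comm ζ z) (appell-cong a x+1≈x+1#)) (trans (*-assoc _ _ _) (*-congˡ (appell-shift a x)))
      polePart : d * (invSuc a * (pow ζ (suc m) * pow x+1 (suc a))) ≈ d * (z * (powerDifference a x + invSuc a * X))
      polePart = begin
        d * (invSuc a * ((ζ * z) * pow x+1 (suc a)))
          ≈⟨ solve 5 (λ d j ζ z p → d :* (j :* ((ζ :* z) :* p)) := (d :* ζ) :* (z :* (j :* p))) refl _ _ _ _ _ ⟩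
        (d * ζ) * (z * (invSuc a * pow x+1 (suc a)))   ≈⟨ *-cong dζ≈d (*-congˡ (trans (*-congˡ (pow-cong (suc a) x+1≈x+1#)) (invSuc*pow-suc a x))) ⟩
        d * (z * (powerDifference a x + invSuc a * X)) ∎

    reflectedω : ℕ → Carrier
    reflectedω n = - (sgn n * ω n)

    leftPoly : ℕ → ℕ → Carrier → Carrier
    leftPoly a b x = sum0 a (λ i → choose a i * (ω (a +ℕ b ∸ i) * pow x i))

    rightPoly : ℕ → ℕ → Carrier → Carrier
    rightPoly a b x = sum0 b (λ i → choose b i * (reflectedω (b +ℕ a ∸ i) * pow x i))

    betaCoeff : ℕ → ℕ → Carrier
    betaCoeff a b = fromℕ (a !) * (fromℕ (b !) * invFact (suc (a +ℕ b)))

    convolution : ℕ → ℕ → ℕ → Carrier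
    convolution m a b = sum< m (λ v → pow ζ v * (pow (fromℕ v) a * pow (fromℕ (m ∸ v)) b))

    polePart leftPart rightPart closedForm : ℕ → ℕ → ℕ → Carrier
    polePart m a b = d * (betaCoeff a b * (pow ζ m * pow (fromℕ m) (suc (a +ℕ b))))
    leftPart m a b = pow ζ m * (sgn b * leftPoly a b (fromℕ m))
    rightPart m a b = sgn a * rightPoly a b (fromℕ m)
    closedForm m a b = polePart m a b + leftPart m a b + rightPart m a b

    pull-out : ∀ x c w P → c * (w * (x * P)) ≈ x * (c * (w * P))
    pull-out = solve 4 (λ x c w P → c :* (w :* (x :* P)) := x :* (c :* (w :* P))) refl

    leftPoly-suc : ∀ a b x → leftPoly (suc a) b x ≈ x * leftPoly a b x + leftPoly a (suc b) x
    leftPoly-suc a b x = trans (sum0-pascal a _) (+-cong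
      (trans (sum0-cong a (λ i → pull-out x _ _ _)) (sym (*-distribˡ-sum0 a x _)))
      (sum0-cong a (λ i → *-congˡ (*-congʳ (reflexive (P.cong (λ k → ω (k ∸ i)) (P.sym (ℕ.+-suc a b))))))))

    rightPoly-suc : ∀ a b x → rightPoly a (suc b) x ≈ x * rightPoly a b x + rightPoly (suc a) b x
    rightPoly-suc a b x = trans (sum0-pascal b _) (+-cong
      (trans (sum0-cong b (λ i → pull-out x _ _ _)) (sym (*-distribˡ-sum0 b x _)))
      (sum0-cong b (λ i → *-congˡ (*-congʳ (reflexive (P.cong (λ k → reflectedω (k ∸ i)) (P.sym (ℕ.+-suc b a))))))))

    betaCoeff-pascal : ∀ a b → betaCoeff a (suc b) + betaCoeff (suc a) b ≈ betaCoeff a b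
    betaCoeff-pascal a b = begin
      fromℕ (a !) * (fromℕ (suc b !) * invFact (suc (a +ℕ suc b))) + fromℕ (suc a !) * (fromℕ (b !) * i)
        ≡⟨ P.cong (λ k → fromℕ (a !) * (fromℕ (suc b !) * invFact (suc k)) + fromℕ (suc a !) * (fromℕ (b !) * i)) (ℕ.+-suc a b) ⟩
      fromℕ (a !) * (fromℕ (suc b !) * i) + fromℕ (suc a !) * (fromℕ (b !) * i)
        ≈⟨ +-cong (*-congˡ (*-congʳ (fromℕ-* (suc b) (b !)))) (*-congʳ (fromℕ-* (suc a) (a !))) ⟩
      fromℕ (a !) * ((fromℕ (suc b) * fromℕ (b !)) * i) + (fromℕ (suc a) * fromℕ (a !)) * (fromℕ (b !) * i)
        ≈⟨ solve 5 (λ A B sa sb i → A :* ((sb :* B) :* i) :+ (sa :* A) :* (B :* i) := A :* (B :* ((sa :+ sb) :* i))) refl _ _ _ _ _ ⟩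
      fromℕ (a !) * (fromℕ (b !) * ((fromℕ (suc a) + fromℕ (suc b)) * i))
        ≈⟨ *-congˡ (*-congˡ (*-congʳ (sym (fromℕ-+ (suc a) (suc b))))) ⟩
      fromℕ (a !) * (fromℕ (b !) * (fromℕ (suc (a +ℕ suc b)) * i))
        ≡⟨ P.cong (λ k → fromℕ (a !) * (fromℕ (b !) * (fromℕ (suc k) * i))) (ℕ.+-suc a b) ⟩
      fromℕ (a !) * (fromℕ (b !) * (fromℕ (suc (suc (a +ℕ b))) * i)) ≈⟨ *-congˡ (*-congˡ (sym (invFact-suc (suc (a +ℕ b))))) ⟩
      betaCoeff a b ∎
      where i = invFact (suc (suc (a +ℕ b)))

    polePart-rec : ∀ m → ShiftRecurrence (fromℕ m) (polePart m)
    polePart-rec m a b = begin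
      d * (betaCoeff a (suc b) * (z * pow x (suc (a +ℕ suc b))))   ≡⟨ P.cong (λ k → d * (betaCoeff a (suc b) * (z * pow x (suc k)))) (ℕ.+-suc a b) ⟩
      d * (betaCoeff a (suc b) * (z * (x * X)))
        ≈⟨ solve 5 (λ d B A z xX → d :* (B :* (z :* xX)) := d :* ((B :+ A) :* (z :* xX)) :- d :* (A :* (z :* xX))) refl d _ (betaCoeff (suc a) b) z (x * X) ⟩
      d * ((betaCoeff a (suc b) + betaCoeff (suc a) b) * (z * (x * X))) - polePart m (suc a) b
        ≈⟨ +-congʳ (trans (*-congˡ (*-congʳ (betaCoeff-pascal a b))) (solve 5 (λ d B z x X → d :* (B :* (z :* (x :* X))) := x :* (d :* (B :* (z :* X)))) refl _ _ _ _ _)) ⟩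
      x * polePart m a b - polePart m (suc a) b ∎
      where
      x = fromℕ m
      z = pow ζ m
      X = pow x (suc (a +ℕ b))

    leftPart-rec : ∀ m → ShiftRecurrence (fromℕ m) (leftPart m)
    leftPart-rec m a b = begin
      z * (sgn (suc b) * leftPoly a (suc b) x)
        ≈⟨ *-congˡ (*-cong (sgn-suc b) (solve 2 (λ p q → q := p :+ q :- p) refl (x * leftPoly a b x) _)) ⟩
      z * (- sgn b * (x * leftPoly a b x + leftPoly a (suc b) x - x * leftPoly a b x)) ≈⟨ *-congˡ (*-congˡ (+-congʳ (sym (leftPoly-suc a b x)))) ⟩
      z * (- sgn b * (leftPoly (suc a) b x - x * leftPoly a b x))
        ≈⟨ solve 5 (λ z s p q x → z :* (:- s :* (q :- x :* p)) := x :* (z :* (s :* p)) :- z :* (s :* q)) refl z (sgn b) (leftPoly a b x) _ x ⟩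
      x * leftPart m a b - leftPart m (suc a) b                                ∎
      where
      x = fromℕ m
      z = pow ζ m

    rightPart-rec : ∀ m → ShiftRecurrence (fromℕ m) (rightPart m)
    rightPart-rec m a b = begin
      sgn a * rightPoly a (suc b) x                                            ≈⟨ *-congˡ (rightPoly-suc a b x) ⟩
      sgn a * (x * rightPoly a b x + rightPoly (suc a) b x)
        ≈⟨ solve 4 (λ s x p q → s :* (x :* p :+ q) := x :* (s :* p) :- (:- s) :* q) refl (sgn a) x _ _ ⟩
      x * rightPart m a b - (- sgn a) * rightPoly (suc a) b x                  ≈⟨ +-congˡ (-‿cong (*-congʳ (sym (sgn-suc a)))) ⟩
      x * rightPart m a b - rightPart m (suc a) b                              ∎
      where x = fromℕ m

    convolution-rec : ∀ m → ShiftRecurrence (fromℕ m) (convolution m)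
    convolution-rec m a b = begin
      convolution m a (suc b)                                         ≈⟨ sum<-cong-< m (λ v v<m → split v (ℕ.<⇒≤ v<m)) ⟩
      sum< m (λ v → x * term a v - term (suc a) v)                    ≈⟨ trans (sum<-- m _ _) (+-congʳ (sym (*-distribˡ-sum< m _ _))) ⟩
      x * convolution m a b - convolution m (suc a) b                 ∎
      where
      x = fromℕ m
      term : ℕ → ℕ → Carrier
      term a v = pow ζ v * (pow (fromℕ v) a * pow (fromℕ (m ∸ v)) b)
      split : ∀ v → v ≤ m → pow ζ v * (pow (fromℕ v) a * pow (fromℕ (m ∸ v)) (suc b)) ≈ x * term a v - term (suc a) v
      split v v≤m = begin
        pow ζ v * (pow (fromℕ v) a * (fromℕ (m ∸ v) * pow (fromℕ (m ∸ v)) b))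
          ≈⟨ solve 5 (λ z p u w q → z :* (p :* (w :* q)) := (u :+ w) :* (z :* (p :* q)) :- z :* ((u :* p) :* q)) refl _ _ (fromℕ v) _ _ ⟩
        (fromℕ v + fromℕ (m ∸ v)) * term a v - term (suc a) v
          ≈⟨ +-congʳ (*-congʳ (trans (sym (fromℕ-+ v (m ∸ v))) (reflexive (P.cong fromℕ (ℕ.m+[n∸m]≡n v≤m))))) ⟩
        x * term a v - term (suc a) v ∎

    -- (m − v)^{b+1} = m (m − v)^b − v (m − v)^b gives the recurrence in b; at b = 0 this is powerSum.
    convolution≈closedForm : ∀ m b a → convolution m a b ≈ closedForm m a b
    convolution≈closedForm m = shiftRecurrence-unique (convolution-rec m)
      (shiftRecurrence-+ (shiftRecurrence-+ (polePart-rec m) (leftPart-rec m)) (rightPart-rec m)) base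
      where
      x = fromℕ m
      z = pow ζ m
      base : ∀ a → convolution m a 0 ≈ closedForm m a 0
      base a = begin
        convolution m a 0                                           ≈⟨ sum<-cong-< m (λ v _ → *-congˡ (*-identityʳ _)) ⟩
        sum< m (λ v → pow ζ v * pow (fromℕ v) a)                    ≈⟨ powerSum a m ⟩
        d * (invSuc a * (z * pow x (suc a))) + z * appell a x - ω a ≈⟨ +-cong (+-cong (*-congˡ (sym beta0)) (*-congˡ left0)) right0 ⟩
        d * (betaCoeff a 0 * (z * pow x (suc (a +ℕ 0)))) + leftPart m a 0 + rightPart m a 0 ∎
        where
        a+0 : a +ℕ 0 ≡ a
        a+0 = ℕ.+-identityʳ a
        beta0 : betaCoeff a 0 * (z * pow x (suc (a +ℕ 0))) ≈ invSuc a * (z * pow x (suc a))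
        beta0 = begin
          betaCoeff a 0 * (z * pow x (suc (a +ℕ 0)))  ≡⟨ P.cong (λ k → fromℕ (a !) * (fromℕ 1 * invFact (suc k)) * (z * pow x (suc k))) a+0 ⟩
          fromℕ (a !) * (fromℕ 1 * invFact (suc a)) * (z * pow x (suc a)) ≈⟨ *-congʳ (*-congˡ (trans (*-congʳ fromℕ-1) (*-identityˡ _))) ⟩
          fromℕ (a !) * invFact (suc a) * (z * pow x (suc a)) ≈⟨ *-congʳ (fromℕ-fact*invFact-suc a) ⟩
          invSuc a * (z * pow x (suc a)) ∎
        left0 : appell a x ≈ sgn 0 * leftPoly a 0 x
        left0 = sym (trans (*-identityˡ _) (sum0-cong a (λ i → *-congˡ (*-congʳ (reflexive (P.cong (λ k → ω (k ∸ i)) a+0))))))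
        right0 : - ω a ≈ rightPart m a 0
        right0 = begin
          - ω a                                 ≈⟨ -‿cong (trans (sym (*-identityˡ _)) (*-congʳ (sym (sgn*sgn a)))) ⟩
          - ((sgn a * sgn a) * ω a)             ≈⟨ -‿cong (*-assoc _ _ _) ⟩
          - (sgn a * (sgn a * ω a))             ≈⟨ -‿distribʳ-* _ _ ⟩
          sgn a * reflectedω a
            ≈⟨ *-congˡ (sym (trans (+-identityʳ _) (trans (*-congʳ (choose-0 0)) (trans (*-identityˡ _) (*-identityʳ _))))) ⟩
          rightPart m a 0                       ∎

  coeffλ : (ℕ → Carrier) → ℕ → ℕ → ℕ → Carrier
  coeffλ w a b i = sgn b * (choose (a +ℕ b ∸ i) (a ∸ i) * (w (a +ℕ b ∸ i) * invFact (a +ℕ b ∸ i)))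

  invFact*invFact*choose : ∀ a b i → i ≤ a →
    (invFact a * invFact b) * choose a i ≈ choose (a +ℕ b ∸ i) (a ∸ i) * (invFact (a +ℕ b ∸ i) * invFact i)
  invFact*invFact*choose a b i i≤a = begin
    (invFact a * invFact b) * choose a i                 ≈⟨ solve 3 (λ x y c → (x :* y) :* c := (c :* x) :* y) refl _ _ _ ⟩
    (choose a i * invFact a) * invFact b                 ≈⟨ *-congʳ (choose*invFact i≤a) ⟩
    (invFact i * invFact (a ∸ i)) * invFact b            ≈⟨ solve 3 (λ x y z → (x :* y) :* z := (y :* z) :* x) refl _ _ _ ⟩
    (invFact (a ∸ i) * invFact b) * invFact i            ≡⟨ P.cong (λ k → (invFact (a ∸ i) * invFact k) * invFact i) (P.sym M∸[a∸i]≡b) ⟩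
    (invFact (a ∸ i) * invFact (M ∸ (a ∸ i))) * invFact i ≈⟨ *-congʳ (choose*invFact a∸i≤M) ⟨
    (choose M (a ∸ i) * invFact M) * invFact i           ≈⟨ *-assoc _ _ _ ⟩
    choose M (a ∸ i) * (invFact M * invFact i)           ∎
    where
    M = a +ℕ b ∸ i
    M≡a∸i+b : M ≡ (a ∸ i) +ℕ b
    M≡a∸i+b = ℕ.+-∸-comm b i≤a
    M∸[a∸i]≡b : M ∸ (a ∸ i) ≡ b
    M∸[a∸i]≡b = P.trans (P.cong (_∸ (a ∸ i)) M≡a∸i+b) (ℕ.m+n∸m≡n (a ∸ i) b)
    a∸i≤M : a ∸ i ≤ M
    a∸i≤M = P.subst (a ∸ i ≤_) (P.sym M≡a∸i+b) (ℕ.m≤m+n (a ∸ i) b)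

  sum0-coeffλ-δℕ : ∀ a b x B → sum0 b (λ i → coeffλ (λ n → δℕ n 0) b a i * (invFact i * (B * pow x i)))
                                  ≈ (invFact a * invFact b) * (B * (pow 0# a * pow x b))
  sum0-coeffλ-δℕ zero b x B = begin
    sum0 b (λ i → coeffλ (λ n → δℕ n 0) b 0 i * (invFact i * (B * pow x i)))  ≈⟨ sum0-single b b ℕ.≤-refl off-diagonal ⟩
    coeffλ (λ n → δℕ n 0) b 0 b * (invFact b * (B * pow x b))
      ≡⟨ P.cong₂ (λ n k → (1# * (choose n k * (δℕ n 0 * invFact n))) * (invFact b * (B * pow x b))) b+0∸b≡0 (ℕ.n∸n≡0 b) ⟩
    (1# * (choose 0 0 * (δℕ 0 0 * invFact 0))) * (invFact b * (B * pow x b))  ≈⟨ *-congʳ one ⟩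
    1# * (invFact b * (B * pow x b))                                          ≈⟨ *-identityˡ _ ⟩
    invFact b * (B * pow x b)
      ≈⟨ *-cong (sym (trans (*-congʳ invFact-0) (*-identityˡ _))) (*-congˡ (sym (*-identityˡ _))) ⟩
    (invFact 0 * invFact b) * (B * (1# * pow x b))                            ∎
    where
    b+0∸b≡0 : b +ℕ 0 ∸ b ≡ 0
    b+0∸b≡0 = P.trans (P.cong (_∸ b) (ℕ.+-identityʳ b)) (ℕ.n∸n≡0 b)
    one : 1# * (choose 0 0 * (δℕ 0 0 * invFact 0)) ≈ 1#
    one = trans (*-identityˡ _) (trans (*-cong (choose-0 0) (*-cong (δℕ-refl 0) invFact-0)) (trans (*-identityˡ _) (*-identityˡ _)))
    off-diagonal : ∀ i → i ≤ b → ¬ i ≡ b → coeffλ (λ n → δℕ n 0) b 0 i * (invFact i * (B * pow x i)) ≈ 0#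
    off-diagonal i i≤b i≢b = trans (*-congʳ (*-congˡ (*-congˡ (trans (*-congʳ (δℕ-≢ b+0∸i≢0)) (zeroˡ _)))))
                                   (trans (*-congʳ (trans (*-congˡ (zeroʳ _)) (zeroʳ _))) (zeroˡ _))
      where
      b+0∸i≢0 : ¬ b +ℕ 0 ∸ i ≡ 0
      b+0∸i≢0 = ℕ.m>n⇒m∸n≢0 (P.subst (i <_) (P.sym (ℕ.+-identityʳ b)) (ℕ.≤∧≢⇒< i≤b i≢b))
  sum0-coeffλ-δℕ (suc a) b x B = begin
    sum0 b (λ i → coeffλ (λ n → δℕ n 0) b (suc a) i * (invFact i * (B * pow x i)))  ≈⟨ sum0-≈0 b vanish ⟩
    0#
      ≈⟨ trans (*-congˡ (trans (*-congˡ (trans (*-congʳ (zeroˡ _)) (zeroˡ _))) (zeroʳ _))) (zeroʳ _) ⟨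
    (invFact (suc a) * invFact b) * (B * (pow 0# (suc a) * pow x b))                ∎
    where
    vanish : ∀ i → i ≤ b → coeffλ (λ n → δℕ n 0) b (suc a) i * (invFact i * (B * pow x i)) ≈ 0#
    vanish i i≤b = trans (*-congʳ (*-congˡ (*-congˡ (trans (*-congʳ (δℕ-≢ (ℕ.m>n⇒m∸n≢0 (ℕ.≤-<-trans i≤b (ℕ.m<m+n b (ℕ.s≤s z≤n)))))) (zeroˡ _)))))
                         (trans (*-congʳ (trans (*-congˡ (zeroʳ _)) (zeroʳ _))) (zeroˡ _))

  module DiagonalSum {ζ d ηα ηβ : Carrier} {ω ω' : ℕ → Carrier}
                     (dζ≈d : d * ζ ≈ d) (rec : OmegaRecurrence ζ d ω)
                     (reflection : ∀ n → ω' n ≈ - (sgn n * ω n) - δℕ n 0)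
                     (ηα≈ηβζ : ηα ≈ ηβ * ζ) where
    open PowerSums dζ≈d rec

    pow-ηα*pow-ηβ : ∀ m v → v ≤ m → pow ηα v * pow ηβ (m ∸ v) ≈ pow ηβ m * pow ζ v
    pow-ηα*pow-ηβ m v v≤m = begin
      pow ηα v * pow ηβ (m ∸ v)                 ≈⟨ *-congʳ (trans (pow-cong v ηα≈ηβζ) (pow-distrib-* ηβ ζ v)) ⟩
      (pow ηβ v * pow ζ v) * pow ηβ (m ∸ v)     ≈⟨ solve 3 (λ p q r → (p :* q) :* r := (p :* r) :* q) refl _ _ _ ⟩
      (pow ηβ v * pow ηβ (m ∸ v)) * pow ζ v     ≈⟨ *-congʳ (trans (sym (pow-+ ηβ v (m ∸ v))) (reflexive (P.cong (pow ηβ) (ℕ.m+[n∸m]≡n v≤m)))) ⟩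
      pow ηβ m * pow ζ v                        ∎

    pow-ηβ*pow-ζ : ∀ m → pow ηβ m * pow ζ m ≈ pow ηα m
    pow-ηβ*pow-ζ m = trans (sym (pow-distrib-* ηβ ζ m)) (pow-cong m (sym ηα≈ηβζ))

    diagonal : ∀ a b k →
      (invFact a * invFact b) * sum1 k (λ v → (pow ηα v * pow ηβ (suc k ∸ v)) * (pow (fromℕ v) a * pow (fromℕ (suc k ∸ v)) b))
        ≈ d * (invFact (suc (a +ℕ b)) * (pow ηα (suc k) * pow (fromℕ (suc k)) (suc (a +ℕ b))))
          + sum0 a (λ i → coeffλ ω a b i * (invFact i * (pow ηα (suc k) * pow (fromℕ (suc k)) i)))
          + sum0 b (λ i → coeffλ ω' b a i * (invFact i * (pow ηβ (suc k) * pow (fromℕ (suc k)) i)))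
    diagonal a b k = begin
      IAB * sum1 k (λ v → (pow ηα v * pow ηβ (m ∸ v)) * P v)
        ≈⟨ *-congˡ (trans (sum1-cong-≤ k (λ v _ v≤k → trans (*-congʳ (pow-ηα*pow-ηβ m v (ℕ.m≤n⇒m≤1+n v≤k))) (*-assoc _ _ _)))
                          (sym (*-distribˡ-sum1 k B _))) ⟩
      IAB * (B * sum1 k g)                                    ≈⟨ *-congˡ (*-congˡ sum1≈closedForm-g0) ⟩
      IAB * (B * (closedForm m a b - g 0))
        ≈⟨ solve 6 (λ i bb p q r g0 → i :* (bb :* ((p :+ q :+ r) :- g0)) := i :* (bb :* p) :+ i :* (bb :* q) :+ (i :* (bb :* r) :- i :* (bb :* g0)))
                   refl IAB B _ _ _ (g 0) ⟩
      IAB * (B * polePart m a b) + IAB * (B * leftPart m a b) + (IAB * (B * rightPart m a b) - IAB * (B * g 0))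
                                                              ≈⟨ +-cong (+-cong pole left) right ⟩
      _ ∎
      where
      m = suc k
      x = fromℕ m
      IAB = invFact a * invFact b
      B = pow ηβ m
      P : ℕ → Carrier
      P v = pow (fromℕ v) a * pow (fromℕ (m ∸ v)) b
      g : ℕ → Carrier
      g v = pow ζ v * P v
      sum1≈closedForm-g0 : sum1 k g ≈ closedForm m a b - g 0
      sum1≈closedForm-g0 = begin
        sum1 k g                    ≈⟨ solve 2 (λ p q → q := (p :+ q) :- p) refl (g 0) (sum1 k g) ⟩
        sum0 k g - g 0              ≈⟨ +-congʳ (sym (sum<-suc≈sum0 k g)) ⟩
        convolution m a b - g 0     ≈⟨ +-congʳ (convolution≈closedForm m b a) ⟩
        closedForm m a b - g 0      ∎
      IAB*betaCoeff : IAB * betaCoeff a b ≈ invFact (suc (a +ℕ b))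
      IAB*betaCoeff = begin
        (invFact a * invFact b) * (fromℕ (a !) * (fromℕ (b !) * iN))
          ≈⟨ solve 5 (λ ia ib fa fb iN → (ia :* ib) :* (fa :* (fb :* iN)) := (ia :* fa) :* ((ib :* fb) :* iN)) refl _ _ _ _ _ ⟩
        (invFact a * fromℕ (a !)) * ((invFact b * fromℕ (b !)) * iN)   ≈⟨ *-cong (invFact*fromℕ-fact a) (*-congʳ (invFact*fromℕ-fact b)) ⟩
        1# * (1# * iN)                                                 ≈⟨ trans (*-identityˡ _) (*-identityˡ _) ⟩
        iN                                                             ∎
        where iN = invFact (suc (a +ℕ b))
      pole : IAB * (B * polePart m a b) ≈ d * (invFact (suc (a +ℕ b)) * (pow ηα m * pow x (suc (a +ℕ b))))
      pole = begin
        IAB * (B * (d * (betaCoeff a b * (pow ζ m * X))))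
          ≈⟨ solve 6 (λ i bb dd D z X → i :* (bb :* (dd :* (D :* (z :* X)))) := dd :* ((i :* D) :* ((bb :* z) :* X))) refl IAB B d (betaCoeff a b) (pow ζ m) X ⟩
        d * ((IAB * betaCoeff a b) * ((B * pow ζ m) * X))              ≈⟨ *-congˡ (*-cong IAB*betaCoeff (*-congʳ (pow-ηβ*pow-ζ m))) ⟩
        d * (invFact (suc (a +ℕ b)) * (pow ηα m * X))                  ∎
        where X = pow x (suc (a +ℕ b))
      left : IAB * (B * leftPart m a b) ≈ sum0 a (λ i → coeffλ ω a b i * (invFact i * (pow ηα m * pow x i)))
      left = begin
        IAB * (B * (pow ζ m * (sgn b * leftPoly a b x)))
          ≈⟨ solve 5 (λ i bb z s r → i :* (bb :* (z :* (s :* r))) := (i :* (bb :* (z :* s))) :* r) refl IAB B (pow ζ m) (sgn b) (leftPoly a b x) ⟩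
        (IAB * (B * (pow ζ m * sgn b))) * leftPoly a b x              ≈⟨ *-distribˡ-sum0 a _ _ ⟩
        sum0 a (λ i → (IAB * (B * (pow ζ m * sgn b))) * (choose a i * (ω (a +ℕ b ∸ i) * pow x i)))
                                                                      ≈⟨ sum0-cong-≤ a term ⟩
        sum0 a (λ i → coeffλ ω a b i * (invFact i * (pow ηα m * pow x i))) ∎
        where
        term : ∀ i → i ≤ a → (IAB * (B * (pow ζ m * sgn b))) * (choose a i * (ω (a +ℕ b ∸ i) * pow x i))
                             ≈ coeffλ ω a b i * (invFact i * (pow ηα m * pow x i))
        term i i≤a = begin
          (IAB * (B * (pow ζ m * sgn b))) * (choose a i * (ω (a +ℕ b ∸ i) * pow x i))
            ≈⟨ solve 7 (λ ia bb z s c w X → (ia :* (bb :* (z :* s))) :* (c :* (w :* X)) := (s :* ((ia :* c) :* w)) :* ((bb :* z) :* X)) refl IAB B (pow ζ m) (sgn b) (choose a i) (ω (a +ℕ b ∸ i)) (pow x i) ⟩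
          (sgn b * ((IAB * choose a i) * ω (a +ℕ b ∸ i))) * ((B * pow ζ m) * pow x i)
            ≈⟨ *-cong (*-congˡ (*-congʳ (invFact*invFact*choose a b i i≤a))) (*-congʳ (pow-ηβ*pow-ζ m)) ⟩
          (sgn b * ((choose (a +ℕ b ∸ i) (a ∸ i) * (invFact (a +ℕ b ∸ i) * invFact i)) * ω (a +ℕ b ∸ i))) * (pow ηα m * pow x i)
            ≈⟨ solve 7 (λ s c iM ii w h X → (s :* ((c :* (iM :* ii)) :* w)) :* (h :* X) := (s :* (c :* (w :* iM))) :* (ii :* (h :* X))) refl _ _ _ _ _ _ _ ⟩
          coeffλ ω a b i * (invFact i * (pow ηα m * pow x i)) ∎
      right : IAB * (B * rightPart m a b) - IAB * (B * g 0) ≈ sum0 b (λ i → coeffλ ω' b a i * (invFact i * (B * pow x i)))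
      right = begin
        IAB * (B * rightPart m a b) - IAB * (B * g 0)
          ≈⟨ +-cong (trans (solve 4 (λ i bb s t → i :* (bb :* (s :* t)) := (i :* (bb :* s)) :* t) refl IAB B (sgn a) (rightPoly a b x)) (*-distribˡ-sum0 b _ _))
                    (-‿cong (sym g0-as-sum)) ⟩
        sum0 b (λ i → (IAB * (B * sgn a)) * (choose b i * (reflectedω (b +ℕ a ∸ i) * pow x i))) - sum0 b (λ i → coeffλ (λ n → δℕ n 0) b a i * (invFact i * (B * pow x i)))
          ≈⟨ +-congʳ (sum0-cong-≤ b term) ⟩
        sum0 b (λ i → coeffλ reflectedω b a i * (invFact i * (B * pow x i))) - sum0 b (λ i → coeffλ (λ n → δℕ n 0) b a i * (invFact i * (B * pow x i)))
          ≈⟨ sum0-- b _ _ ⟨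
        sum0 b (λ i → coeffλ reflectedω b a i * (invFact i * (B * pow x i)) - coeffλ (λ n → δℕ n 0) b a i * (invFact i * (B * pow x i)))
          ≈⟨ sum0-cong b (λ i → trans (solve 6 (λ s c y e iM t → (s :* (c :* (y :* iM))) :* t :- (s :* (c :* (e :* iM))) :* t := (s :* (c :* ((y :- e) :* iM))) :* t) refl _ _ _ _ _ _)
                                      (*-congʳ (*-congˡ (*-congˡ (*-congʳ (sym (reflection (b +ℕ a ∸ i)))))))) ⟩
        sum0 b (λ i → coeffλ ω' b a i * (invFact i * (B * pow x i))) ∎
        where
        term : ∀ i → i ≤ b → (IAB * (B * sgn a)) * (choose b i * (reflectedω (b +ℕ a ∸ i) * pow x i))
                             ≈ coeffλ reflectedω b a i * (invFact i * (B * pow x i))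
        term i i≤b = begin
          (IAB * (B * sgn a)) * (choose b i * (reflectedω (b +ℕ a ∸ i) * pow x i))
            ≈⟨ solve 6 (λ ia bb s c w X → (ia :* (bb :* s)) :* (c :* (w :* X)) := (s :* ((ia :* c) :* w)) :* (bb :* X)) refl IAB B (sgn a) (choose b i) _ (pow x i) ⟩
          (sgn a * ((IAB * choose b i) * reflectedω (b +ℕ a ∸ i))) * (B * pow x i)
            ≈⟨ *-congʳ (*-congˡ (*-congʳ (trans (*-congʳ (*-comm _ _)) (invFact*invFact*choose b a i i≤b)))) ⟩
          (sgn a * ((choose (b +ℕ a ∸ i) (b ∸ i) * (invFact (b +ℕ a ∸ i) * invFact i)) * reflectedω (b +ℕ a ∸ i))) * (B * pow x i)
            ≈⟨ solve 6 (λ s c iM ii w X → (s :* ((c :* (iM :* ii)) :* w)) :* X := (s :* (c :* (w :* iM))) :* (ii :* X)) refl _ _ _ _ _ _ ⟩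
          coeffλ reflectedω b a i * (invFact i * (B * pow x i)) ∎
        -- The δ-part of the reflected coefficients accounts for the term v = 0 of the convolution.
        g0-as-sum : sum0 b (λ i → coeffλ (λ n → δℕ n 0) b a i * (invFact i * (B * pow x i))) ≈ IAB * (B * g 0)
        g0-as-sum = trans (sum0-coeffλ-δℕ a b x B) (*-congˡ (*-congˡ (sym (*-identityˡ _))))

  -- Coefficients of products of q-series

  infix 9 [_]*_
  [_]*_ : ∀ {p} {A : Set p} → Dec A → Carrier → Carrier
  [ d ]* x = if ⌊ d ⌋ then x else 0#

  module _ {p} {A : Set p} where

    []*-yes : ∀ (d : Dec A) {x} → A → [ d ]* x ≈ x
    []*-yes (yes _) _ = refl
    []*-yes (no ¬a) a = ⊥-elim (¬a a)

    []*-no : ∀ (d : Dec A) {x} → ¬ A → [ d ]* x ≈ 0#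
    []*-no (yes a) ¬a = ⊥-elim (¬a a)
    []*-no (no _)  _  = refl

    []*-cong : ∀ (d : Dec A) {x y} → (A → x ≈ y) → [ d ]* x ≈ [ d ]* y
    []*-cong (yes a) x≈y = x≈y a
    []*-cong (no _)  _   = refl

    []*-≈0 : ∀ (d : Dec A) {x} → x ≈ 0# → [ d ]* x ≈ 0#
    []*-≈0 (yes _) x≈0 = x≈0
    []*-≈0 (no _)  _   = refl

    *-distribˡ-[]* : ∀ (d : Dec A) x y → x * [ d ]* y ≈ [ d ]* (x * y)
    *-distribˡ-[]* (yes _) x y = refl
    *-distribˡ-[]* (no _)  x y = zeroʳ x

    []*-+ : ∀ (d : Dec A) x y → [ d ]* x + [ d ]* y ≈ [ d ]* (x + y)
    []*-+ (yes _) x y = refl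
    []*-+ (no _)  x y = +-identityˡ _

    []*-sum1 : ∀ (d : Dec A) L (f : ℕ → Carrier) → [ d ]* sum1 L f ≈ sum1 L (λ i → [ d ]* f i)
    []*-sum1 (yes _) L f = refl
    []*-sum1 (no _)  L f = sym (sum1-≈0 L (λ _ _ _ → refl))

  []*-⇔ : ∀ {p q} {A : Set p} {B : Set q} (d : Dec A) (e : Dec B) {x} → (A → B) → (B → A) → [ d ]* x ≈ [ e ]* x
  []*-⇔ (yes a) (yes b) _ _ = refl
  []*-⇔ (yes a) (no ¬b) f _ = ⊥-elim (¬b (f a))
  []*-⇔ (no ¬a) (yes b) _ g = ⊥-elim (¬a (g b))
  []*-⇔ (no _)  (no _)  _ _ = refl

  divisorSum : ℕ → ℕ → (ℕ → Carrier) → Carrier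
  divisorSum L k f = sum1 L (λ u → sum1 L (λ v → [ u *ℕ v ≟ k ]* f v))

  v≤u*v : ∀ {u v} → 1 ≤ u → v ≤ u *ℕ v
  v≤u*v {suc u} {v} _ = ℕ.m≤m+n v (u *ℕ v)

  u≤u*v : ∀ {u v} → 1 ≤ v → u ≤ u *ℕ v
  u≤u*v {u} {v} 1≤v = P.subst (u ≤_) (ℕ.*-comm v u) (v≤u*v 1≤v)

  divisorSum-extend : ∀ k L f → k ≤ L → divisorSum k k f ≈ divisorSum L k f
  divisorSum-extend k L f k≤L = sym (trans
    (sum1-cong-≤ L (λ u 1≤u _ → sum1-extend k L k≤L (λ v k<v _ → []*-no (u *ℕ v ≟ k) (λ uv≡k → ℕ.<⇒≱ k<v (P.subst (v ≤_) uv≡k (v≤u*v 1≤u))))))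
    (sum1-extend k L k≤L (λ u k<u _ → sum1-≈0 k (λ v 1≤v _ → []*-no (u *ℕ v ≟ k) (λ uv≡k → ℕ.<⇒≱ k<u (P.subst (u ≤_) uv≡k (u≤u*v 1≤v)))))))

  *-distribˡ-divisorSum : ∀ n x f → x * divisorSum n n f ≈ divisorSum n n (λ m → x * f m)
  *-distribˡ-divisorSum n x f = trans (*-distribˡ-sum1 n _ _) (sum1-cong n (λ u → trans (*-distribˡ-sum1 n _ _) (sum1-cong n (λ m → *-distribˡ-[]* (u *ℕ m ≟ n) _ _))))

  divisorSum-+ : ∀ n f g → divisorSum n n f + divisorSum n n g ≈ divisorSum n n (λ m → f m + g m)
  divisorSum-+ n f g = trans (sym (sum1-+ n _ _)) (sum1-cong n (λ u → trans (sym (sum1-+ n _ _)) (sum1-cong n (λ m → []*-+ (u *ℕ m ≟ n) _ _))))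

  sum1-divisorSum : ∀ n L (f : ℕ → ℕ → Carrier) → sum1 L (λ j → divisorSum n n (f j)) ≈ divisorSum n n (λ m → sum1 L (λ j → f j m))
  sum1-divisorSum n L f = trans (sum1-comm L n _) (sum1-cong n (λ u → trans (sum1-comm L n _) (sum1-cong n (λ m → sym ([]*-sum1 (u *ℕ m ≟ n) L _)))))

  divisorSum-cong-≤ : ∀ n {f g} → (∀ m → 1 ≤ m → m ≤ n → f m ≈ g m) → divisorSum n n f ≈ divisorSum n n g
  divisorSum-cong-≤ n f≈g = sum1-cong n (λ u → sum1-cong-≤ n (λ m 1≤m m≤n → []*-cong (u *ℕ m ≟ n) (λ _ → f≈g m 1≤m m≤n)))

  sum1⁴ : ℕ → (ℕ → ℕ → ℕ → ℕ → Carrier) → Carrier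
  sum1⁴ n F = sum1 n (λ a → sum1 n (λ b → sum1 n (λ c → sum1 n (λ d → F a b c d))))

  sum1⁴-cong-≤ : ∀ n {F G : ℕ → ℕ → ℕ → ℕ → Carrier} →
    (∀ a b c d → 1 ≤ a → 1 ≤ b → 1 ≤ c → 1 ≤ d → F a b c d ≈ G a b c d) → sum1⁴ n F ≈ sum1⁴ n G
  sum1⁴-cong-≤ n F≈G = sum1-cong-≤ n (λ a 1≤a _ → sum1-cong-≤ n (λ b 1≤b _ →
    sum1-cong-≤ n (λ c 1≤c _ → sum1-cong-≤ n (λ d 1≤d _ → F≈G a b c d 1≤a 1≤b 1≤c 1≤d))))

  sum1⁴-cong : ∀ n {F G : ℕ → ℕ → ℕ → ℕ → Carrier} → (∀ a b c d → F a b c d ≈ G a b c d) → sum1⁴ n F ≈ sum1⁴ n G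
  sum1⁴-cong n F≈G = sum1⁴-cong-≤ n (λ a b c d _ _ _ _ → F≈G a b c d)

  sum1⁴-+ : ∀ n (F G : ℕ → ℕ → ℕ → ℕ → Carrier) → sum1⁴ n (λ a b c d → F a b c d + G a b c d) ≈ sum1⁴ n F + sum1⁴ n G
  sum1⁴-+ n F G = trans (sum1-cong n (λ a → trans (sum1-cong n (λ b → trans (sum1-cong n (λ c → sum1-+ n _ _)) (sum1-+ n _ _))) (sum1-+ n _ _))) (sum1-+ n _ _)

  sum1-sum1⁴-comm : ∀ n L (F : ℕ → ℕ → ℕ → ℕ → ℕ → Carrier) →
    sum1 L (λ k → sum1⁴ n (F k)) ≈ sum1⁴ n (λ a b c d → sum1 L (λ k → F k a b c d))
  sum1-sum1⁴-comm n L F = trans (sum1-comm L n _) (sum1-cong n (λ a → trans (sum1-comm L n _)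
    (sum1-cong n (λ b → trans (sum1-comm L n _) (sum1-cong n (λ c → sum1-comm L n _))))))

  sum1⁴-swap : ∀ n (F : ℕ → ℕ → ℕ → ℕ → Carrier) → sum1⁴ n F ≈ sum1⁴ n (λ a b c d → F c d a b)
  sum1⁴-swap n F = begin
    sum1 n (λ a → sum1 n (λ b → sum1 n (λ c → sum1 n (λ d → F a b c d))))   ≈⟨ sum1-cong n (λ a → sum1-comm n n _) ⟩
    sum1 n (λ a → sum1 n (λ c → sum1 n (λ b → sum1 n (λ d → F a b c d))))   ≈⟨ sum1-comm n n _ ⟩
    sum1 n (λ c → sum1 n (λ a → sum1 n (λ b → sum1 n (λ d → F a b c d))))
      ≈⟨ sum1-cong n (λ c → trans (sum1-cong n (λ a → sum1-comm n n _)) (sum1-comm n n _)) ⟩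
    sum1 n (λ c → sum1 n (λ d → sum1 n (λ a → sum1 n (λ b → F a b c d))))   ∎

  sum1-[≟]*[≟∸] : ∀ n x y (A B : Carrier) → 1 ≤ x → 1 ≤ y →
    sum1 n (λ k → [ x ≟ k ]* A * [ y ≟ n ∸ k ]* B) ≈ [ x +ℕ y ≟ n ]* (A * B)
  sum1-[≟]*[≟∸] n x y A B 1≤x 1≤y with x +ℕ y ≟ n
  ... | yes x+y≡n = trans (sum1-single n x 1≤x x≤n (λ k _ _ k≢x → trans (*-congʳ ([]*-no (x ≟ k) (λ x≡k → k≢x (P.sym x≡k)))) (zeroˡ _)))
                          (*-cong ([]*-yes (x ≟ x) P.refl) ([]*-yes (y ≟ n ∸ x) (P.sym (P.trans (P.cong (_∸ x) (P.sym x+y≡n)) (ℕ.m+n∸m≡n x y)))))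
    where x≤n = P.subst (x ≤_) x+y≡n (ℕ.m≤m+n x y)
  ... | no x+y≢n = sum1-≈0 n (λ k _ k≤n → term k k≤n)
    where
    term : ∀ k → k ≤ n → [ x ≟ k ]* A * [ y ≟ n ∸ k ]* B ≈ 0#
    term k k≤n with x ≟ k | y ≟ n ∸ k
    ... | no _       | _          = zeroˡ _
    ... | yes _      | no _       = zeroʳ _
    ... | yes P.refl | yes y≡n∸x = ⊥-elim (x+y≢n (P.trans (P.cong (x +ℕ_) y≡n∸x) (ℕ.m+[n∸m]≡n k≤n)))

  1≤u*v : ∀ {u v} → 1 ≤ u → 1 ≤ v → 1 ≤ u *ℕ v
  1≤u*v 1≤u 1≤v = ℕ.≤-trans 1≤v (v≤u*v 1≤u)

  sum0-divisorSum*divisorSum : ∀ n (x y : Carrier) (f g : ℕ → Carrier) →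
    sum0 n (λ k → (x * divisorSum k k f) * (y * divisorSum (n ∸ k) (n ∸ k) g))
      ≈ (x * y) * sum1⁴ n (λ u₁ v₁ u₂ v₂ → [ u₁ *ℕ v₁ +ℕ u₂ *ℕ v₂ ≟ n ]* (f v₁ * g v₂))
  sum0-divisorSum*divisorSum n x y f g = begin
    (x * 0#) * (y * divisorSum n n g) + sum1 n (λ k → (x * divisorSum k k f) * (y * divisorSum (n ∸ k) (n ∸ k) g))
      ≈⟨ +-cong (trans (*-congʳ (zeroʳ _)) (zeroˡ _)) (sum1-cong-≤ n (λ k _ k≤n → trans
            (*-cong (*-congˡ (divisorSum-extend k n f k≤n)) (*-congˡ (divisorSum-extend (n ∸ k) n g (ℕ.m∸n≤m n k))))
            (solve 4 (λ x y p q → (x :* p) :* (y :* q) := (x :* y) :* (p :* q)) refl _ _ _ _))) ⟩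
    0# + sum1 n (λ k → (x * y) * (divisorSum n k f * divisorSum n (n ∸ k) g))           ≈⟨ +-identityˡ _ ⟩
    sum1 n (λ k → (x * y) * (divisorSum n k f * divisorSum n (n ∸ k) g))                ≈⟨ *-distribˡ-sum1 n _ _ ⟨
    (x * y) * sum1 n (λ k → divisorSum n k f * divisorSum n (n ∸ k) g)
      ≈⟨ *-congˡ (trans (sum1-cong n expand) (sum1-sum1⁴-comm n n _)) ⟩
    (x * y) * sum1⁴ n (λ u₁ v₁ u₂ v₂ → sum1 n (λ k → [ u₁ *ℕ v₁ ≟ k ]* f v₁ * [ u₂ *ℕ v₂ ≟ n ∸ k ]* g v₂))
      ≈⟨ *-congˡ (sum1⁴-cong-≤ n (λ u₁ v₁ u₂ v₂ 1≤u₁ 1≤v₁ 1≤u₂ 1≤v₂ → sum1-[≟]*[≟∸] n (u₁ *ℕ v₁) (u₂ *ℕ v₂) (f v₁) (g v₂) (1≤u*v 1≤u₁ 1≤v₁) (1≤u*v 1≤u₂ 1≤v₂))) ⟩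
    (x * y) * sum1⁴ n (λ u₁ v₁ u₂ v₂ → [ u₁ *ℕ v₁ +ℕ u₂ *ℕ v₂ ≟ n ]* (f v₁ * g v₂))     ∎
    where
    expand : ∀ k → divisorSum n k f * divisorSum n (n ∸ k) g
                   ≈ sum1⁴ n (λ u₁ v₁ u₂ v₂ → [ u₁ *ℕ v₁ ≟ k ]* f v₁ * [ u₂ *ℕ v₂ ≟ n ∸ k ]* g v₂)
    expand k = trans (*-distribʳ-sum1 n _ _) (sum1-cong n (λ u₁ → trans (*-distribʳ-sum1 n _ _) (sum1-cong n (λ v₁ →
                 trans (*-distribˡ-sum1 n _ _) (sum1-cong n (λ u₂ → *-distribˡ-sum1 n _ _))))))

  sum1⁴-trichotomy : ∀ n (h : ℕ → ℕ → Carrier) →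
    sum1⁴ n (λ u₁ v₁ u₂ v₂ → [ u₁ *ℕ v₁ +ℕ u₂ *ℕ v₂ ≟ n ]* h v₁ v₂)
      ≈ sum1⁴ n (λ u₁ v₁ u₂ v₂ → [ u₁ *ℕ v₁ +ℕ u₂ *ℕ v₂ ≟ n ]* [ u₂ <? u₁ ]* h v₁ v₂)
        + sum1⁴ n (λ u₁ v₁ u₂ v₂ → [ u₁ *ℕ v₁ +ℕ u₂ *ℕ v₂ ≟ n ]* [ u₁ <? u₂ ]* h v₁ v₂)
        + sum1⁴ n (λ u₁ v₁ u₂ v₂ → [ u₁ *ℕ v₁ +ℕ u₂ *ℕ v₂ ≟ n ]* [ u₁ ≟ u₂ ]* h v₁ v₂)
  sum1⁴-trichotomy n h = trans (sum1⁴-cong n split) (trans (sum1⁴-+ n _ _) (+-congʳ (sum1⁴-+ n _ _)))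
    where
    split : ∀ u₁ v₁ u₂ v₂ → [ u₁ *ℕ v₁ +ℕ u₂ *ℕ v₂ ≟ n ]* h v₁ v₂
      ≈ [ u₁ *ℕ v₁ +ℕ u₂ *ℕ v₂ ≟ n ]* [ u₂ <? u₁ ]* h v₁ v₂ + [ u₁ *ℕ v₁ +ℕ u₂ *ℕ v₂ ≟ n ]* [ u₁ <? u₂ ]* h v₁ v₂
        + [ u₁ *ℕ v₁ +ℕ u₂ *ℕ v₂ ≟ n ]* [ u₁ ≟ u₂ ]* h v₁ v₂
    split u₁ v₁ u₂ v₂ with u₁ *ℕ v₁ +ℕ u₂ *ℕ v₂ ≟ n
    ... | no _  = sym (trans (+-identityʳ _) (+-identityʳ _))
    ... | yes _ with ℕ.<-cmp u₁ u₂
    ...   | tri< u₁<u₂ u₁≢u₂ u₂≮u₁ = sym (trans (+-cong (+-cong ([]*-no (u₂ <? u₁) u₂≮u₁) ([]*-yes (u₁ <? u₂) u₁<u₂)) ([]*-no (u₁ ≟ u₂) u₁≢u₂))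
                                                (trans (+-identityʳ _) (+-identityˡ _)))
    ...   | tri≈ u₁≮u₂ u₁≡u₂ u₂≮u₁ = sym (trans (+-cong (+-cong ([]*-no (u₂ <? u₁) u₂≮u₁) ([]*-no (u₁ <? u₂) u₁≮u₂)) ([]*-yes (u₁ ≟ u₂) u₁≡u₂))
                                                (trans (+-congʳ (+-identityˡ _)) (+-identityˡ _)))
    ...   | tri> u₁≮u₂ u₁≢u₂ u₂<u₁ = sym (trans (+-cong (+-cong ([]*-yes (u₂ <? u₁) u₂<u₁) ([]*-no (u₁ <? u₂) u₁≮u₂)) ([]*-no (u₁ ≟ u₂) u₁≢u₂))
                                                (trans (+-identityʳ _) (+-identityʳ _)))

  sum1²-[+≟] : ∀ n m (h : ℕ → ℕ → Carrier) → 1 ≤ m → m ≤ n →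
    sum1 n (λ v₁ → sum1 n (λ v₂ → [ v₁ +ℕ v₂ ≟ m ]* h v₁ v₂)) ≈ sum1 (m ∸ 1) (λ v → h v (m ∸ v))
  sum1²-[+≟] n m@(suc m-1) h _ m≤n = begin
    sum1 n (λ v₁ → sum1 n (λ v₂ → [ v₁ +ℕ v₂ ≟ m ]* h v₁ v₂))   ≈⟨ sum1-cong n inner ⟩
    sum1 n (λ v₁ → [ v₁ <? m ]* h v₁ (m ∸ v₁))
      ≈⟨ sum1-extend m-1 n (ℕ.≤-trans (ℕ.n≤1+n m-1) m≤n) (λ v₁ m-1<v₁ _ → []*-no (v₁ <? m) (λ v₁<m → ℕ.<⇒≱ m-1<v₁ (ℕ.≤-pred v₁<m))) ⟩
    sum1 m-1 (λ v₁ → [ v₁ <? m ]* h v₁ (m ∸ v₁))                 ≈⟨ sum1-cong-≤ m-1 (λ v₁ _ v₁≤m-1 → []*-yes (v₁ <? m) (s≤s v₁≤m-1)) ⟩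
    sum1 m-1 (λ v → h v (m ∸ v))                                 ∎
    where
    inner : ∀ v₁ → sum1 n (λ v₂ → [ v₁ +ℕ v₂ ≟ m ]* h v₁ v₂) ≈ [ v₁ <? m ]* h v₁ (m ∸ v₁)
    inner v₁ with v₁ <? m
    ... | yes v₁<m = trans (sum1-single n (m ∸ v₁) (ℕ.m<n⇒0<n∸m v₁<m) (ℕ.≤-trans (ℕ.m∸n≤m m v₁) m≤n)
                             (λ v₂ _ _ v₂≢m∸v₁ → []*-no (v₁ +ℕ v₂ ≟ m) (λ v₁+v₂≡m → v₂≢m∸v₁ (P.trans (P.sym (ℕ.m+n∸m≡n v₁ v₂)) (P.cong (_∸ v₁) v₁+v₂≡m)))))
                           ([]*-yes (v₁ +ℕ (m ∸ v₁) ≟ m) (ℕ.m+[n∸m]≡n (ℕ.<⇒≤ v₁<m)))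
    ... | no v₁≮m = sum1-≈0 n (λ v₂ 1≤v₂ _ → []*-no (v₁ +ℕ v₂ ≟ m) (λ v₁+v₂≡m → v₁≮m (P.subst (v₁ <_) v₁+v₂≡m (ℕ.m<m+n v₁ 1≤v₂))))

  sum1-[u*≟]*[≟] : ∀ n u w A → 1 ≤ u → 1 ≤ w → sum1 n (λ m → [ u *ℕ m ≟ n ]* [ w ≟ m ]* A) ≈ [ u *ℕ w ≟ n ]* A
  sum1-[u*≟]*[≟] n u w A 1≤u 1≤w with w ≤? n
  ... | yes w≤n = trans (sum1-single n w 1≤w w≤n (λ m _ _ m≢w → []*-≈0 (u *ℕ m ≟ n) ([]*-no (w ≟ m) (λ w≡m → m≢w (P.sym w≡m)))))
                        ([]*-cong (u *ℕ w ≟ n) (λ _ → []*-yes (w ≟ w) P.refl))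
  ... | no w≰n  = trans (sum1-≈0 n (λ m _ m≤n → []*-≈0 (u *ℕ m ≟ n) ([]*-no (w ≟ m) (λ w≡m → w≰n (P.subst (_≤ n) (P.sym w≡m) m≤n)))))
                        (sym ([]*-no (u *ℕ w ≟ n) (λ uw≡n → w≰n (P.subst (w ≤_) uw≡n (v≤u*v 1≤u)))))

  sum1⁴-diagonal : ∀ n (h : ℕ → ℕ → Carrier) →
    sum1⁴ n (λ u₁ v₁ u₂ v₂ → [ u₁ *ℕ v₁ +ℕ u₂ *ℕ v₂ ≟ n ]* [ u₁ ≟ u₂ ]* h v₁ v₂)
      ≈ divisorSum n n (λ m → sum1 (m ∸ 1) (λ v → h v (m ∸ v)))
  sum1⁴-diagonal n h = sum1-cong-≤ n (λ u 1≤u u≤n → begin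
    sum1 n (λ v₁ → sum1 n (λ u₂ → sum1 n (λ v₂ → [ u *ℕ v₁ +ℕ u₂ *ℕ v₂ ≟ n ]* [ u ≟ u₂ ]* h v₁ v₂)))   ≈⟨ sum1-comm n n _ ⟩
    sum1 n (λ u₂ → sum1 n (λ v₁ → sum1 n (λ v₂ → [ u *ℕ v₁ +ℕ u₂ *ℕ v₂ ≟ n ]* [ u ≟ u₂ ]* h v₁ v₂)))
      ≈⟨ sum1-single n u 1≤u u≤n (λ u₂ _ _ u₂≢u → sum1-≈0 n (λ v₁ _ _ → sum1-≈0 n (λ v₂ _ _ →
           []*-≈0 (u *ℕ v₁ +ℕ u₂ *ℕ v₂ ≟ n) ([]*-no (u ≟ u₂) (λ u≡u₂ → u₂≢u (P.sym u≡u₂)))))) ⟩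
    sum1 n (λ v₁ → sum1 n (λ v₂ → [ u *ℕ v₁ +ℕ u *ℕ v₂ ≟ n ]* [ u ≟ u ]* h v₁ v₂))
      ≈⟨ sum1-cong n (λ v₁ → sum1-cong n (λ v₂ → []*-cong (u *ℕ v₁ +ℕ u *ℕ v₂ ≟ n) (λ _ → []*-yes (u ≟ u) P.refl))) ⟩
    sum1 n (λ v₁ → sum1 n (λ v₂ → [ u *ℕ v₁ +ℕ u *ℕ v₂ ≟ n ]* h v₁ v₂))                               ≈⟨ group-by-v₁+v₂ u 1≤u ⟨
    sum1 n (λ m → [ u *ℕ m ≟ n ]* G m)                                                                ∎)
    where
    G : ℕ → Carrier
    G m = sum1 (m ∸ 1) (λ v → h v (m ∸ v))
    group-by-v₁+v₂ : ∀ u → 1 ≤ u → sum1 n (λ m → [ u *ℕ m ≟ n ]* G m) ≈ sum1 n (λ v₁ → sum1 n (λ v₂ → [ u *ℕ v₁ +ℕ u *ℕ v₂ ≟ n ]* h v₁ v₂))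
    group-by-v₁+v₂ u 1≤u = begin
      sum1 n (λ m → [ u *ℕ m ≟ n ]* G m)
        ≈⟨ sum1-cong-≤ n (λ m 1≤m m≤n → trans ([]*-cong (u *ℕ m ≟ n) (λ _ → sym (sum1²-[+≟] n m h 1≤m m≤n)))
                                              (trans ([]*-sum1 (u *ℕ m ≟ n) n _) (sum1-cong n (λ v₁ → []*-sum1 (u *ℕ m ≟ n) n _)))) ⟩
      sum1 n (λ m → sum1 n (λ v₁ → sum1 n (λ v₂ → [ u *ℕ m ≟ n ]* [ v₁ +ℕ v₂ ≟ m ]* h v₁ v₂)))
        ≈⟨ trans (sum1-comm n n _) (sum1-cong n (λ v₁ → sum1-comm n n _)) ⟩
      sum1 n (λ v₁ → sum1 n (λ v₂ → sum1 n (λ m → [ u *ℕ m ≟ n ]* [ v₁ +ℕ v₂ ≟ m ]* h v₁ v₂)))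
        ≈⟨ sum1-cong-≤ n (λ v₁ 1≤v₁ _ → sum1-cong n (λ v₂ → trans (sum1-[u*≟]*[≟] n u (v₁ +ℕ v₂) (h v₁ v₂) 1≤u (ℕ.≤-trans 1≤v₁ (ℕ.m≤m+n v₁ v₂)))
             ([]*-⇔ (u *ℕ (v₁ +ℕ v₂) ≟ n) (u *ℕ v₁ +ℕ u *ℕ v₂ ≟ n) (P.trans (P.sym (ℕ.*-distribˡ-+ u v₁ v₂))) (P.trans (ℕ.*-distribˡ-+ u v₁ v₂))))) ⟩
      sum1 n (λ v₁ → sum1 n (λ v₂ → [ u *ℕ v₁ +ℕ u *ℕ v₂ ≟ n ]* h v₁ v₂)) ∎

  -- Roots of unity

  toℕ-⊖ : ∀ {M} (α β : Fin (suc M)) → toℕ (α ⊖ β) ≡ (toℕ α +ℕ (suc M ∸ toℕ β)) % suc M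
  toℕ-⊖ α β = Fin.toℕ-fromℕ< _

  ⊖-self : ∀ {M} (α : Fin (suc M)) → α ⊖ α ≡ Fin.zero
  ⊖-self {M} α = Fin.toℕ-injective (P.trans (toℕ-⊖ α α)
    (P.trans (P.cong (_% suc M) (ℕ.m+[n∸m]≡n (ℕ.<⇒≤ (Fin.toℕ<n α)))) (n%n≡0 (suc M))))

  toℕ-⊖≡0⇒≡ : ∀ {M} (α β : Fin (suc M)) → toℕ (α ⊖ β) ≡ 0 → α ≡ β
  toℕ-⊖≡0⇒≡ α β ≡0 = Fin.toℕ-injective ([a+[N∸b]]%N≡0⇒a≡b (Fin.toℕ<n α) (Fin.toℕ<n β) (P.trans (P.sym (toℕ-⊖ α β)) ≡0))

  module PrimitiveRoot {M : ℕ} {η : Carrier} (prim : IsPrimitiveRoot (suc M) η) where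

    N = suc M

    ζ : Fin N → Fin N → Carrier
    ζ α β = pow η (toℕ (α ⊖ β))

    pow-N*q : ∀ q → pow η (N *ℕ q) ≈ 1#
    pow-N*q q = trans (pow-* η N q) (trans (pow-cong q (proj₁ prim)) (pow-1# q))

    pow-% : ∀ x → pow η (x % N) ≈ pow η x
    pow-% x = sym (begin
      pow η x                                ≡⟨ P.cong (pow η) (P.trans (m≡m%n+[m/n]*n x N) (P.cong (x % N +ℕ_) (ℕ.*-comm (x / N) N))) ⟩
      pow η (x % N +ℕ N *ℕ (x / N))          ≈⟨ pow-+ η (x % N) (N *ℕ (x / N)) ⟩
      pow η (x % N) * pow η (N *ℕ (x / N))   ≈⟨ *-congˡ (pow-N*q (x / N)) ⟩
      pow η (x % N) * 1#                     ≈⟨ *-identityʳ _ ⟩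
      pow η (x % N)                          ∎)

    ζ≈ : ∀ α β → ζ α β ≈ pow η (toℕ α +ℕ (N ∸ toℕ β))
    ζ≈ α β = trans (reflexive (P.cong (pow η) (toℕ-⊖ α β))) (pow-% (toℕ α +ℕ (N ∸ toℕ β)))

    pow-α≈pow-β*ζ : ∀ α β → pow η (toℕ α) ≈ pow η (toℕ β) * ζ α β
    pow-α≈pow-β*ζ α β = sym (begin
      pow η (toℕ β) * ζ α β                                ≈⟨ *-congˡ (ζ≈ α β) ⟩
      pow η (toℕ β) * pow η (toℕ α +ℕ (N ∸ toℕ β))         ≈⟨ pow-+ η (toℕ β) (toℕ α +ℕ (N ∸ toℕ β)) ⟨
      pow η (toℕ β +ℕ (toℕ α +ℕ (N ∸ toℕ β)))              ≡⟨ P.cong (pow η) (b+[a+[N∸b]]≡a+N (ℕ.<⇒≤ (Fin.toℕ<n β))) ⟩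
      pow η (toℕ α +ℕ N)                                   ≈⟨ pow-+ η (toℕ α) N ⟩
      pow η (toℕ α) * pow η N                              ≈⟨ *-congˡ (proj₁ prim) ⟩
      pow η (toℕ α) * 1#                                   ≈⟨ *-identityʳ _ ⟩
      pow η (toℕ α)                                        ∎)

    ζ*ζ : ∀ α β → ζ α β * ζ β α ≈ 1#
    ζ*ζ α β = begin
      ζ α β * ζ β α                                        ≈⟨ *-cong (ζ≈ α β) (ζ≈ β α) ⟩
      pow η (toℕ α +ℕ (N ∸ toℕ β)) * pow η (toℕ β +ℕ (N ∸ toℕ α)) ≈⟨ pow-+ η (toℕ α +ℕ (N ∸ toℕ β)) (toℕ β +ℕ (N ∸ toℕ α)) ⟨
      pow η ((toℕ α +ℕ (N ∸ toℕ β)) +ℕ (toℕ β +ℕ (N ∸ toℕ α)))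
        ≡⟨ P.cong (pow η) ([a+[N∸b]]+[b+[N∸a]]≡N+N (ℕ.<⇒≤ (Fin.toℕ<n α)) (ℕ.<⇒≤ (Fin.toℕ<n β))) ⟩
      pow η (N +ℕ N)                                       ≈⟨ pow-+ η N N ⟩
      pow η N * pow η N                                    ≈⟨ *-cong (proj₁ prim) (proj₁ prim) ⟩
      1# * 1#                                              ≈⟨ *-identityˡ _ ⟩
      1#                                                   ∎

    ζ-self : ∀ α → ζ α α ≈ 1#
    ζ-self α = reflexive (P.cong (λ γ → pow η (toℕ γ)) (⊖-self α))

    ζ≉1 : ∀ {α β} → α ≢ β → ¬ ζ α β ≈ 1#
    ζ≉1 {α} {β} α≢β = proj₂ prim (toℕ (α ⊖ β)) (ℕ.n≢0⇒n>0 (λ ≡0 → α≢β (toℕ-⊖≡0⇒≡ α β ≡0))) (Fin.toℕ<n (α ⊖ β))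

    δ-⊖ : ∀ (α β : Fin N) → δ (α ⊖ β) Fin.zero ≈ δ α β
    δ-⊖ α β with α Fin.≟ β
    ... | yes P.refl = reflexive (P.cong (λ γ → δ γ Fin.zero) (⊖-self α))
    ... | no α≢β     = []*-no (α ⊖ β Fin.≟ Fin.zero) (λ ≡0 → α≢β (toℕ-⊖≡0⇒≡ α β (P.cong toℕ ≡0)))

    δ*ζ : ∀ α β → δ α β * ζ α β ≈ δ α β
    δ*ζ α β with α Fin.≟ β
    ... | yes P.refl = trans (*-identityˡ _) (ζ-self α)
    ... | no _       = zeroˡ _

    ζ≉1⊎ζ≈1 : ∀ α β → (¬ ζ α β ≈ 1#) ⊎ (ζ α β ≈ 1#)
    ζ≉1⊎ζ≈1 α β with α Fin.≟ β
    ... | yes P.refl = inj₂ (ζ-self α)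
    ... | no α≢β     = inj₁ (ζ≉1 α≢β)

  δ-comm : ∀ {M} (α β : Fin (suc M)) → δ α β ≈ δ β α
  δ-comm α β = []*-⇔ (α Fin.≟ β) (β Fin.≟ α) P.sym P.sym

  -- The product formula

  lam-suc : ∀ {M} (w : ℕ → Fin (suc M) → Carrier) γ a b i → i ≤ a →
    lam w (suc i) (suc a) (suc b) γ ≈ coeffλ (λ k → w k γ) a b i
  lam-suc w γ a b i i≤a = reflexive (P.cong (λ K → sgn b * (fromℕ (K C (a ∸ i)) * (w K γ * invℕ (K !)))) K≡a+b∸i)
    where
    K≡a+b∸i : a +ℕ suc b ∸ i ∸ 1 ≡ a +ℕ b ∸ i
    K≡a+b∸i = P.cong (_∸ 1) (P.trans (P.cong (_∸ i) (ℕ.+-suc a b)) (ℕ.+-∸-assoc 1 (ℕ.≤-trans i≤a (ℕ.m≤m+n a b))))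

  *-bracket1 : ∀ {M} η s (α : Fin (suc M)) n x →
    x * bracket1 η s α n ≈ divisorSum n n (λ m → x * (invFact (s ∸ 1) * (pow η (toℕ α *ℕ m) * pow (fromℕ m) (s ∸ 1))))
  *-bracket1 η s α n x = trans (*-congˡ (*-distribˡ-divisorSum n _ _)) (*-distribˡ-divisorSum n _ _)

  module ProductFormula {M : ℕ} {η : Carrier} (prim : IsPrimitiveRoot (suc M) η)
                        (ω : ℕ → Fin (suc M) → Carrier) (isΩ : IsOmega M η ω)
                        (a b : ℕ) (α β : Fin (suc M)) where
    open PrimitiveRoot prim

    recurrence : ∀ θ κ → OmegaRecurrence (ζ θ κ) (δ θ κ) (λ k → ω k (θ ⊖ κ))
    recurrence θ κ = omegaRecurrence _ (δ*ζ θ κ) (λ n → trans (+-congʳ (*-congʳ (sym (δ-⊖ θ κ)))) (proj₂ (isΩ (θ ⊖ κ)) n))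

    reflection : ∀ k → ω k (β ⊖ α) ≈ - (sgn k * ω k (α ⊖ β)) - δℕ k 0
    reflection = omega-reflection (ζ*ζ α β) (trans (*-congʳ (δ-comm α β)) (trans (δ*ζ β α) (δ-comm β α)))
      (ζ≉1⊎ζ≈1 β α) (recurrence α β) (omegaRecurrence-congᵈ (δ-comm β α) (recurrence β α))

    open DiagonalSum (δ*ζ α β) (recurrence α β) reflection (pow-α≈pow-β*ζ α β)

    IAB : Carrier
    IAB = invFact a * invFact b

    h : ℕ → ℕ → Carrier
    h v₁ v₂ = pow η (toℕ α *ℕ v₁ +ℕ toℕ β *ℕ v₂) * (pow (fromℕ v₁) a * pow (fromℕ v₂) b)

    h-split : ∀ v₁ v₂ → h v₁ v₂ ≈ (pow (pow η (toℕ α)) v₁ * pow (pow η (toℕ β)) v₂) * (pow (fromℕ v₁) a * pow (fromℕ v₂) b)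
    h-split v₁ v₂ = *-congʳ (trans (pow-+ η (toℕ α *ℕ v₁) (toℕ β *ℕ v₂)) (*-cong (pow-* η (toℕ α) v₁) (pow-* η (toℕ β) v₂)))

    product : ∀ n → prodCoeff (bracket1 η (suc a) α) (bracket1 η (suc b) β) n
                      ≈ IAB * sum1⁴ n (λ u₁ v₁ u₂ v₂ → [ u₁ *ℕ v₁ +ℕ u₂ *ℕ v₂ ≟ n ]* h v₁ v₂)
    product n = trans (sum0-divisorSum*divisorSum n (invFact a) (invFact b) _ _)
      (*-congˡ (sum1⁴-cong n (λ u₁ v₁ u₂ v₂ → []*-cong (u₁ *ℕ v₁ +ℕ u₂ *ℕ v₂ ≟ n) (λ _ →
        trans (solve 4 (λ p x q y → (p :* x) :* (q :* y) := (p :* q) :* (x :* y)) refl _ _ _ _)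
              (*-congʳ (sym (pow-+ η (toℕ α *ℕ v₁) (toℕ β *ℕ v₂))))))))

    swapped : ∀ n → IAB * sum1⁴ n (λ u₁ v₁ u₂ v₂ → [ u₁ *ℕ v₁ +ℕ u₂ *ℕ v₂ ≟ n ]* [ u₁ <? u₂ ]* h v₁ v₂)
                      ≈ bracket2 η (suc b) (suc a) β α n
    swapped n = sym (*-cong (*-comm _ _) (trans (sum1⁴-swap n _) (sum1⁴-cong n (λ u₁ v₁ u₂ v₂ →
      trans ([]*-cong (u₂ *ℕ v₂ +ℕ u₁ *ℕ v₁ ≟ n) (λ _ → []*-cong (u₁ <? u₂) (λ _ →
              *-cong (reflexive (P.cong (pow η) (ℕ.+-comm (toℕ β *ℕ v₂) (toℕ α *ℕ v₁)))) (*-comm _ _))))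
            ([]*-⇔ (u₂ *ℕ v₂ +ℕ u₁ *ℕ v₁ ≟ n) (u₁ *ℕ v₁ +ℕ u₂ *ℕ v₂ ≟ n) (P.trans (ℕ.+-comm (u₁ *ℕ v₁) (u₂ *ℕ v₂))) (P.trans (ℕ.+-comm (u₂ *ℕ v₂) (u₁ *ℕ v₁))))))))

    poleTerm leftTerms rightTerms : ℕ → Carrier
    poleTerm m = δ α β * (invFact (a +ℕ suc b) * (pow η (toℕ α *ℕ m) * pow (fromℕ m) (a +ℕ suc b)))
    leftTerms m = sum1 (suc a) (λ j → lam ω j (suc a) (suc b) (α ⊖ β) * (invFact (j ∸ 1) * (pow η (toℕ α *ℕ m) * pow (fromℕ m) (j ∸ 1))))
    rightTerms m = sum1 (suc b) (λ j → lam ω j (suc b) (suc a) (β ⊖ α) * (invFact (j ∸ 1) * (pow η (toℕ β *ℕ m) * pow (fromℕ m) (j ∸ 1))))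

    diagonalTerm : ∀ k → IAB * sum1 k (λ v → h v (suc k ∸ v)) ≈ poleTerm (suc k) + leftTerms (suc k) + rightTerms (suc k)
    diagonalTerm k = begin
      IAB * sum1 k (λ v → h v (m ∸ v))         ≈⟨ *-congˡ (sum1-cong k (λ v → h-split v (m ∸ v))) ⟩
      IAB * sum1 k (λ v → (pow ηα v * pow ηβ (m ∸ v)) * (pow (fromℕ v) a * pow (fromℕ (m ∸ v)) b)) ≈⟨ diagonal a b k ⟩
      d * (invFact (suc (a +ℕ b)) * (pow ηα m * pow x (suc (a +ℕ b))))
        + sum0 a (λ i → coeffλ (λ k → ω k (α ⊖ β)) a b i * (invFact i * (pow ηα m * pow x i)))
        + sum0 b (λ i → coeffλ (λ k → ω k (β ⊖ α)) b a i * (invFact i * (pow ηβ m * pow x i)))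
                                               ≈⟨ +-cong (+-cong pole left) right ⟩
      poleTerm m + leftTerms m + rightTerms m  ∎
      where
      m = suc k
      x = fromℕ m
      d = δ α β
      ηα = pow η (toℕ α)
      ηβ = pow η (toℕ β)
      pole : d * (invFact (suc (a +ℕ b)) * (pow ηα m * pow x (suc (a +ℕ b)))) ≈ poleTerm m
      pole = trans (*-congˡ (*-congˡ (*-congʳ (sym (pow-* η (toℕ α) m)))))
                   (reflexive (P.cong (λ N → d * (invFact N * (pow η (toℕ α *ℕ m) * pow x N))) (P.sym (ℕ.+-suc a b))))
      left : sum0 a (λ i → coeffλ (λ k → ω k (α ⊖ β)) a b i * (invFact i * (pow ηα m * pow x i))) ≈ leftTerms m
      left = sym (trans (sum1-suc≈sum0 a _) (sum0-cong-≤ a (λ i i≤a →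
        *-cong (lam-suc ω (α ⊖ β) a b i i≤a) (*-congˡ (*-congʳ (pow-* η (toℕ α) m))))))
      right : sum0 b (λ i → coeffλ (λ k → ω k (β ⊖ α)) b a i * (invFact i * (pow ηβ m * pow x i))) ≈ rightTerms m
      right = sym (trans (sum1-suc≈sum0 b _) (sum0-cong-≤ b (λ i i≤b →
        *-cong (lam-suc ω (β ⊖ α) b a i i≤b) (*-congˡ (*-congʳ (pow-* η (toℕ β) m))))))

    diagonalPart : ∀ n → IAB * sum1⁴ n (λ u₁ v₁ u₂ v₂ → [ u₁ *ℕ v₁ +ℕ u₂ *ℕ v₂ ≟ n ]* [ u₁ ≟ u₂ ]* h v₁ v₂)
      ≈ δ α β * bracket1 η (suc a +ℕ suc b) α n
        + sum1 (suc a) (λ j → lam ω j (suc a) (suc b) (α ⊖ β) * bracket1 η j α n)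
        + sum1 (suc b) (λ j → lam ω j (suc b) (suc a) (β ⊖ α) * bracket1 η j β n)
    diagonalPart n = begin
      IAB * sum1⁴ n (λ u₁ v₁ u₂ v₂ → [ u₁ *ℕ v₁ +ℕ u₂ *ℕ v₂ ≟ n ]* [ u₁ ≟ u₂ ]* h v₁ v₂)
        ≈⟨ trans (*-congˡ (sum1⁴-diagonal n h)) (*-distribˡ-divisorSum n IAB _) ⟩
      divisorSum n n (λ m → IAB * sum1 (m ∸ 1) (λ v → h v (m ∸ v)))
        ≈⟨ divisorSum-cong-≤ n (λ { (suc k) _ _ → diagonalTerm k }) ⟩
      divisorSum n n (λ m → poleTerm m + leftTerms m + rightTerms m)
        ≈⟨ trans (+-congʳ (divisorSum-+ n poleTerm leftTerms)) (divisorSum-+ n _ rightTerms) ⟨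
      divisorSum n n poleTerm + divisorSum n n leftTerms + divisorSum n n rightTerms
        ≈⟨ +-cong (+-cong (*-bracket1 η (suc a +ℕ suc b) α n (δ α β)) (Σ-bracket1 (suc a) (suc b) α (α ⊖ β))) (Σ-bracket1 (suc b) (suc a) β (β ⊖ α)) ⟨
      δ α β * bracket1 η (suc a +ℕ suc b) α n
        + sum1 (suc a) (λ j → lam ω j (suc a) (suc b) (α ⊖ β) * bracket1 η j α n)
        + sum1 (suc b) (λ j → lam ω j (suc b) (suc a) (β ⊖ α) * bracket1 η j β n) ∎
      where
      Σ-bracket1 : ∀ s t (θ γ : Fin (suc M)) → sum1 s (λ j → lam ω j s t γ * bracket1 η j θ n)
        ≈ divisorSum n n (λ m → sum1 s (λ j → lam ω j s t γ * (invFact (j ∸ 1) * (pow η (toℕ θ *ℕ m) * pow (fromℕ m) (j ∸ 1)))))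
      Σ-bracket1 s t θ γ = trans (sum1-cong s (λ j → *-bracket1 η j θ n _)) (sum1-divisorSum n s _)


proposition5p6 : ∀ {c ℓ} (F : CharZeroField c ℓ) (M : ℕ) →
  let open WithField F in
  (η : Carrier) → IsPrimitiveRoot (suc M) η →
  (ω : ℕ → Fin (suc M) → Carrier) → IsOmega M η ω →
  (s t : ℕ) → 1 ≤ s → 1 ≤ t → (α β : Fin (suc M)) → (n : ℕ) →
  prodCoeff (bracket1 η s α) (bracket1 η t β) n
    ≈ bracket2 η s t α β n + bracket2 η t s β α n
      + δ α β * bracket1 η (s +ℕ t) α n
      + sum1 s (λ j → lam ω j s t (α ⊖ β) * bracket1 η j α n)
      + sum1 t (λ j → lam ω j t s (β ⊖ α) * bracket1 η j β n)
proposition5p6 F M η prim ω isΩ (suc a) (suc b) (s≤s z≤n) (s≤s z≤n) α β n = begin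
  prodCoeff (bracket1 η (suc a) α) (bracket1 η (suc b) β) n                  ≈⟨ product n ⟩
  IAB * sum1⁴ n (λ u₁ v₁ u₂ v₂ → [ u₁ *ℕ v₁ +ℕ u₂ *ℕ v₂ ≟ n ]* h v₁ v₂)    ≈⟨ *-congˡ (sum1⁴-trichotomy n h) ⟩
  IAB * (Q> + Q< + Q=)
    ≈⟨ solve 4 (λ i p q r → i :* (p :+ q :+ r) := i :* p :+ i :* q :+ i :* r) refl _ _ _ _ ⟩
  IAB * Q> + IAB * Q< + IAB * Q=                                             ≈⟨ +-cong (+-congˡ (swapped n)) (diagonalPart n) ⟩
  bracket2 η (suc a) (suc b) α β n + bracket2 η (suc b) (suc a) β α n + (A + B + C)
                                                                             ≈⟨ solve 5 (λ p q r x y → p :+ q :+ (r :+ x :+ y) := p :+ q :+ r :+ x :+ y) refl _ _ _ _ _ ⟩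
  bracket2 η (suc a) (suc b) α β n + bracket2 η (suc b) (suc a) β α n + A + B + C ∎
  where
  open WithField F
  open Lemmas F
  open import Relation.Binary.Reasoning.Setoid setoid
  open ProductFormula prim ω isΩ a b α β
  Q> = sum1⁴ n (λ u₁ v₁ u₂ v₂ → [ u₁ *ℕ v₁ +ℕ u₂ *ℕ v₂ ≟ n ]* [ u₂ <? u₁ ]* h v₁ v₂)
  Q< = sum1⁴ n (λ u₁ v₁ u₂ v₂ → [ u₁ *ℕ v₁ +ℕ u₂ *ℕ v₂ ≟ n ]* [ u₁ <? u₂ ]* h v₁ v₂)
  Q= = sum1⁴ n (λ u₁ v₁ u₂ v₂ → [ u₁ *ℕ v₁ +ℕ u₂ *ℕ v₂ ≟ n ]* [ u₁ ≟ u₂ ]* h v₁ v₂)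
  A = δ α β * bracket1 η (suc a +ℕ suc b) α n
  B = sum1 (suc a) (λ j → lam ω j (suc a) (suc b) (α ⊖ β) * bracket1 η j α n)
  C = sum1 (suc b) (λ j → lam ω j (suc b) (suc a) (β ⊖ α) * bracket1 η j β n)
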